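{- Let $\mathbb{F}$ be a field, $\mathcal{S}\subseteq 2^{[n]}$ a Sperner family and $h:\mathcal{S}\to 2^{[n]}$ a function with $h(S)\subseteq S$ for every $S\in\mathcal{S}$. Let $\mathbb{G}=\mathbb{G}(\mathcal{S},h)=\{f_{S,h(S)}: S\in\mathcal{S}\}\cup\{x_i^2-x_i: i\in[n]\}\subseteq\mathbb{F}[x_1,\dots,x_n]$. Then $\mathbb{G}$ is a Gröbner basis of the ideal $\langle\mathbb{G}\rangle$ with respect to some term order if and only if $|\mathcal{H}(\mathcal{S})|=|\mathcal{F}(\mathcal{S},h)|$.
   Context: $[n]=\{1,\dots,n\}$. A Sperner family is a family of sets none of whose members contains another. For $H\subseteq S\subseteq[n]$ put $\mathbf{x}_H=\prod_{i\in H}x_i$ and $f_{S,H}(\mathbf{x})=\mathbf{x}_H\prod_{i\in S\setminus H}(x_i-1)$. Let $\mathcal{P}_S=\{S\cup B: B\subseteq [n]\setminus S\}$ and $\mathcal{Q}_{S,H}=\{H\cup B: B\subseteq[n]\setminus S\}$; define $\mathcal{H}(\mathcal{S})=2^{[n]}\setminus\bigcup_{S\in\mathcal{S}}\mathcal{P}_S$ and $\mathcal{F}(\mathcal{S},h)=2^{[n]}\setminus\bigcup_{S\in\mathcal{S}}\mathcal{Q}_{S,h(S)}$. A term order is a total order on monomials with $1$ minimal and compatible with multiplication by monomials; $\mathrm{lm}(f)$ is the largest monomial of $f$. A finite $\mathbb{G}\subseteq I$ is a Gröbner basis of the ideal $I$ for a term order if for every nonzero $f\in I$ some $g\in\mathbb{G}$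 has $\mathrm{lm}(g)$ dividing $\mathrm{lm}(f)$. -}

module Defs where

open import Level using (Level; _⊔_; suc)
open import Algebra.Bundles using (CommutativeRing)
open import Data.Nat as ℕ using (ℕ; zero; suc)
open import Data.Bool using (Bool; true; false; if_then_else_)
open import Data.Fin as Fin using (Fin)
open import Data.Fin.Subset using (Subset; _∪_; _─_; ∁; inside; outside) renaming (_⊆_ to _⊆ₛ_)
open import Data.Fin.Subset.Properties using (_⊆?_; _∈?_)
open import Data.Vec as Vec using (Vec; []; _∷_; replicate; zipWith; tabulate)
open import Data.Vec.Properties using (≡-dec)
open import Data.List as List using (List; []; _∷_; _++_; map; filter; length; allFin; concatMap; foldr)
open import Data.List.Relation.Unary.All using (All)
import Data.List.Membership.Propositional as LMem
import Data.List.Membership.DecPropositional as LDecMem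
open import Data.Sum using (_⊎_)
open import Data.Product using (Σ; ∃; ∃₂; _×_; _,_; proj₁; proj₂)
open import Relation.Nullary using (¬_; Dec; yes; no; ¬?)
open import Relation.Nullary.Decidable using (⌊_⌋)
open import Relation.Binary.PropositionalEquality using (_≡_; _≢_)
import Data.Bool.Properties as BoolP

record Field (c ℓ : Level) : Set (Level.suc (c ⊔ ℓ)) where
  field
    commutativeRing : CommutativeRing c ℓ
  open CommutativeRing commutativeRing public
  field
    0≉1     : ¬ (0# ≈ 1#)
    inverse : ∀ x → ¬ (x ≈ 0#) → Σ Carrier λ y → (x * y) ≈ 1#

Mon : ℕ → Set
Mon n = Vec ℕ n

oneₘ : ∀ {n} → Mon n
oneₘ = replicate _ 0

_·ₘ_ : ∀ {n} → Mon n → Mon n → Mon n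
_·ₘ_ = zipWith ℕ._+_

_∣ₘ_ : ∀ {n} → Mon n → Mon n → Set
m ∣ₘ m' = ∃ λ u → (u ·ₘ m) ≡ m'

_≟ₘ_ : ∀ {n} (m m' : Mon n) → Dec (m ≡ m')
_≟ₘ_ = ≡-dec ℕ._≟_

varₘ : ∀ {n} → Fin n → Mon n
varₘ i = tabulate λ j → if ⌊ i Fin.≟ j ⌋ then 1 else 0

record TermOrder (n : ℕ) : Set₁ where
  field
    _≼_      : Mon n → Mon n → Set
    refl≼    : ∀ m → m ≼ m
    antisym≼ : ∀ {m m'} → m ≼ m' → m' ≼ m → m ≡ m'
    trans≼   : ∀ {m m' m''} → m ≼ m' → m' ≼ m'' → m ≼ m''
    total≼   : ∀ m m' → (m ≼ m') ⊎ (m' ≼ m)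
    one-min  : ∀ m → oneₘ ≼ m
    compat   : ∀ {m m'} u → m ≼ m' → (u ·ₘ m) ≼ (u ·ₘ m')

  _≺_ : Mon n → Mon n → Set
  m ≺ m' = (m ≼ m') × (m ≢ m')

-- Polynomials in F[x₁,…,xₙ], represented as finite formal sums
-- (lists of coefficient/monomial pairs); two polynomials are equal
-- when all their coefficients agree (in the field's setoid equality).

module Poly {c ℓ} (F : Field c ℓ) (n : ℕ) where
  open Field F

  Pol : Set c
  Pol = List (Carrier × Mon n)

  coeff : Pol → Mon n → Carrier
  coeff [] m = 0#
  coeff ((a , m') ∷ p) m with m' ≟ₘ m
  ... | yes _ = a + coeff p m
  ... | no  _ = coeff p m

  _≈ₚ_ : Pol → Pol → Set ℓ
  p ≈ₚ q = ∀ m → coeff p m ≈ coeff q m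

  0ₚ : Pol
  0ₚ = []

  constₚ : Carrier → Pol
  constₚ a = (a , oneₘ) ∷ []

  1ₚ : Pol
  1ₚ = constₚ 1#

  var : Fin n → Pol
  var i = (1# , varₘ i) ∷ []

  _+ₚ_ : Pol → Pol → Pol
  _+ₚ_ = _++_

  -ₚ_ : Pol → Pol
  -ₚ_ = map λ am → (- proj₁ am , proj₂ am)

  _-ₚ_ : Pol → Pol → Pol
  p -ₚ q = p +ₚ (-ₚ q)

  _*ₚ_ : Pol → Pol → Pol
  p *ₚ q = concatMap (λ am → map (λ bm → (proj₁ am * proj₁ bm , proj₂ am ·ₘ proj₂ bm)) q) p

  sumₚ : List Pol → Pol
  sumₚ = foldr _+ₚ_ 0ₚ

  prodₚ : List Pol → Pol
  prodₚ = foldr _*ₚ_ 1ₚ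

  _∈⟨_⟩ : Pol → List Pol → Set (c ⊔ ℓ)
  f ∈⟨ G ⟩ = ∃ λ (qgs : List (Pol × Pol)) →
               All (λ qg → proj₂ qg LMem.∈ G) qgs ×
               (f ≈ₚ sumₚ (map (λ qg → proj₁ qg *ₚ proj₂ qg) qgs))

  IsLM : TermOrder n → Pol → Mon n → Set ℓ
  IsLM O f m = ¬ (coeff f m ≈ 0#) × (∀ m' → m ≺ m' → coeff f m' ≈ 0#)
    where open TermOrder O

  IsGroebnerBasis : TermOrder n → List Pol → Set (c ⊔ ℓ)
  IsGroebnerBasis O G =
    ∀ f → f ∈⟨ G ⟩ → ∀ m → IsLM O f m →
    ∃₂ λ g m' → (g LMem.∈ G) × IsLM O g m' × (m' ∣ₘ m)

  xₛ : Subset n → Pol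
  xₛ H = prodₚ (map var (filter (λ i → i ∈? H) (allFin n)))

  fSH : Subset n → Subset n → Pol
  fSH S H = xₛ H *ₚ prodₚ (map (λ i → var i -ₚ 1ₚ) (filter (λ i → i ∈? (S ─ H)) (allFin n)))

  𝔾 : List (Subset n) → (Subset n → Subset n) → List Pol
  𝔾 𝒮 h = map (λ S → fSH S (h S)) 𝒮 ++ map (λ i → (var i *ₚ var i) -ₚ var i) (allFin n)

-- Set systems on [n].  A family of subsets is given by a list
-- (duplicates are irrelevant).

allSubsets : ∀ n → List (Subset n)
allSubsets zero    = [] ∷ []
allSubsets (suc n) = map (inside ∷_) (allSubsets n) ++ map (outside ∷_) (allSubsets n)

_≟ₛ_ : ∀ {n} (S T : Subset n) → Dec (S ≡ T)
_≟ₛ_ = ≡-dec BoolP._≟_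

module _ {n : ℕ} where
  open LDecMem (_≟ₛ_ {n}) using () renaming (_∈?_ to _∈L?_)

  IsSperner : List (Subset n) → Set
  IsSperner 𝒮 = ∀ {S T} → S LMem.∈ 𝒮 → T LMem.∈ 𝒮 → S ⊆ₛ T → S ≡ T

  𝒫 : Subset n → List (Subset n)
  𝒫 S = map (S ∪_) (filter (λ B → B ⊆? ∁ S) (allSubsets n))

  𝒬 : Subset n → Subset n → List (Subset n)
  𝒬 S H = map (H ∪_) (filter (λ B → B ⊆? ∁ S) (allSubsets n))

  ℋ : List (Subset n) → List (Subset n)
  ℋ 𝒮 = filter (λ T → ¬? (T ∈L? concatMap 𝒫 𝒮)) (allSubsets n)

  ℱ : List (Subset n) → (Subset n → Subset n) → List (Subset n)
  ℱ 𝒮 h = filter (λ T → ¬? (T ∈L? concatMap (λ S → 𝒬 S (h S)) 𝒮)) (allSubsets n)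

module Submission where

-- Write 𝐱 W = ∏_{i∈W} xᵢ, ℋ = ℋ(𝒮), ℱ = ℱ(𝒮,h).  Evaluation ev_X at the 0/1
-- point X ∈ ℱ kills every generator of 𝔾, hence the whole ideal.  For
-- d : ℱ → F the functional Λ_d = Σ_X d_X ev_X takes at 𝐱 W the value
-- ψ_d(W) = Σ_X d_X [W ⊆ X].
--
--  * Reduction: for W ⊇ S ∈ 𝒮 the ideal element 𝐱(W∖S)·f_S has top monomial
--    𝐱 W and otherwise only monomials 𝐱 V, V ⊊ W; so by induction on |W|,
--    ψ_d vanishes on a down-closed family once it vanishes on its part in ℋ.
--    With Möbius inversion on ℱ, d ↦ ψ_d|ℋ is injective: |ℱ| ≤ |ℋ|.
--  * (⇐) If |ℋ| = |ℱ| that map is onto, so for T ∈ ℋ some Λ_d kills the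
--    ideal, is 1 at 𝐱 T and 0 at every 𝐱 V with T ⊄ V: 𝐱 T is never a leading
--    monomial.  Every other leading monomial is divisible by some xᵢ² or some
--    𝐱 S, S ∈ 𝒮 — for every term order.
--  * (⇒) If |ℱ| < |ℋ| there are more sets Y ∉ ℱ than sets W ∉ ℋ.  The ideal
--    elements f_{∁S,Y∖S}·f_{S,h(S)} (Y ∈ 𝒬_{S,h(S)}) have lowest monomial 𝐱 Y,
--    so a nontrivial combination P of them vanishes at every 𝐱 W with W ∉ ℋ
--    yet P ≠ 0; no leading monomial of 𝔾 divides lm(P).
--
-- Equality in F is
-- not decidable, so dimension counting and the choice of leading monomials
-- happen under double negation, which is harmless as those goals are
-- negative.

open import Defs
open import Level using (Level)
open import Data.Nat using (ℕ)
open import Data.Fin.Subset using (Subset; _⊆_)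
open import Data.List using (List; length)
open import Data.List.Membership.Propositional using (_∈_)
open import Data.Product using (∃)
open import Data.Sum using (_⊎_)
open import Function.Bundles using (_⇔_)
open import Relation.Binary.PropositionalEquality using (_≡_)

-- Subsets of [n] are bit vectors; inclusion is decided by a Boolean test
-- that computes well under pattern matching.

module Subsets where

  open import Data.Nat using (suc; _≤_; _<_; z≤n; s≤s)
  import Data.Nat.Properties as NP
  open import Data.Bool using (Bool; true; false; _∧_; _∨_; not)
  open import Data.Bool.Properties as BoolP using (∧-zeroʳ)
  open import Data.Fin as Fin using (Fin)
  open import Data.Fin.Subset using (_∪_; _─_; ∁) renaming (_∈_ to _∈ₛ_)
  open import Data.Vec using ([]; _∷_)
  open import Data.Vec.Base using (here; there)
  open import Data.Empty using (⊥-elim)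
  open import Relation.Nullary using (Dec; yes; no)
  open import Relation.Binary.PropositionalEquality using (_≢_; refl; sym; cong)

  size : ∀ {n} → Subset n → ℕ
  size []          = 0
  size (true ∷ p)  = suc (size p)
  size (false ∷ p) = size p

  size≤n : ∀ {n} (p : Subset n) → size p ≤ n
  size≤n []          = z≤n
  size≤n (true ∷ p)  = s≤s (size≤n p)
  size≤n (false ∷ p) = NP.m≤n⇒m≤1+n (size≤n p)

  infix 4 _⊆ᵇ_ _⊑_

  _⊆ᵇ_ : ∀ {n} → Subset n → Subset n → Bool
  []      ⊆ᵇ []      = true
  (a ∷ A) ⊆ᵇ (x ∷ X) = (not a ∨ x) ∧ (A ⊆ᵇ X)

  -- Inclusion as a proposition; the record keeps both sets inferable.
  record _⊑_ {n} (A B : Subset n) : Set where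
    constructor sub
    field holds : (A ⊆ᵇ B) ≡ true
  open _⊑_ public

  _⊑?_ : ∀ {n} (A B : Subset n) → Dec (A ⊑ B)
  A ⊑? B with (A ⊆ᵇ B) BoolP.≟ true
  ... | yes e = yes (sub e)
  ... | no ne = no (λ s → ne (holds s))

  ⊑-tail : ∀ {n a x} {A X : Subset n} → (a ∷ A) ⊑ (x ∷ X) → A ⊑ X
  ⊑-tail {a = true}  {x = true}  (sub e) = sub e
  ⊑-tail {a = true}  {x = false} (sub ())
  ⊑-tail {a = false}         (sub e) = sub e

  ⊑-refl : ∀ {n} (A : Subset n) → A ⊑ A
  ⊑-refl []          = sub refl
  ⊑-refl (true ∷ A)  = sub (holds (⊑-refl A))
  ⊑-refl (false ∷ A) = sub (holds (⊑-refl A))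

  ⊑-trans : ∀ {n} {A B C : Subset n} → A ⊑ B → B ⊑ C → A ⊑ C
  ⊑-trans {A = []} {[]} {[]} _ _ = sub refl
  ⊑-trans {A = false ∷ A} {b ∷ B} {c ∷ C} e f =
    sub (holds (⊑-trans {A = A} (⊑-tail e) (⊑-tail {a = b} f)))
  ⊑-trans {A = true ∷ A} {true ∷ B} {true ∷ C} e f = sub (holds (⊑-trans {A = A} (⊑-tail e) (⊑-tail f)))
  ⊑-trans {A = true ∷ A} {false ∷ B} (sub ()) _
  ⊑-trans {A = true ∷ A} {true ∷ B} {false ∷ C} _ (sub ())

  ⊑⇒size≤ : ∀ {n} {A B : Subset n} → A ⊑ B → size A ≤ size B
  ⊑⇒size≤ {A = []} {[]} _ = z≤n
  ⊑⇒size≤ {A = false ∷ A} {false ∷ B} e = ⊑⇒size≤ {A = A} (⊑-tail e)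
  ⊑⇒size≤ {A = false ∷ A} {true ∷ B} e = NP.m≤n⇒m≤1+n (⊑⇒size≤ {A = A} (⊑-tail e))
  ⊑⇒size≤ {A = true ∷ A} {true ∷ B} e = s≤s (⊑⇒size≤ {A = A} (⊑-tail e))
  ⊑⇒size≤ {A = true ∷ A} {false ∷ B} (sub ())

  -- A proper subset is strictly smaller: the measure of all inductions on sets.
  ⊏⇒size< : ∀ {n} {A B : Subset n} → A ⊑ B → A ≢ B → size A < size B
  ⊏⇒size< {A = []} {[]} _ ne = ⊥-elim (ne refl)
  ⊏⇒size< {A = false ∷ A} {false ∷ B} e ne = ⊏⇒size< {A = A} (⊑-tail e) (λ q → ne (cong (false ∷_) q))
  ⊏⇒size< {A = false ∷ A} {true ∷ B} e ne = s≤s (⊑⇒size≤ {A = A} (⊑-tail e))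
  ⊏⇒size< {A = true ∷ A} {true ∷ B} e ne = s≤s (⊏⇒size< {A = A} (⊑-tail e) (λ q → ne (cong (true ∷_) q)))
  ⊏⇒size< {A = true ∷ A} {false ∷ B} (sub ()) ne

  ⊑∧size≥⇒≡ : ∀ {n} {A B : Subset n} → A ⊑ B → size B ≤ size A → A ≡ B
  ⊑∧size≥⇒≡ {A = A} {B} e le with A ≟ₛ B
  ... | yes q = q
  ... | no q  = ⊥-elim (NP.<⇒≱ (⊏⇒size< e q) le)

  -- A union is included in X iff both parts are: this makes evaluation at
  -- a 0/1 point multiplicative.
  ∪-⊆ᵇ : ∀ {n} (A B X : Subset n) → ((A ∪ B) ⊆ᵇ X) ≡ ((A ⊆ᵇ X) ∧ (B ⊆ᵇ X))
  ∪-⊆ᵇ [] [] [] = refl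
  ∪-⊆ᵇ (a ∷ A) (b ∷ B) (x ∷ X) rewrite ∪-⊆ᵇ A B X = step a b x
    where
    step : ∀ a b x → (not (a ∨ b) ∨ x) ∧ ((A ⊆ᵇ X) ∧ (B ⊆ᵇ X))
                       ≡ (((not a ∨ x) ∧ (A ⊆ᵇ X)) ∧ ((not b ∨ x) ∧ (B ⊆ᵇ X)))
    step true  true  true  = refl
    step true  false true  = refl
    step false true  true  = refl
    step false false true  = refl
    step true  _     false = refl
    step false true  false = sym (∧-zeroʳ (A ⊆ᵇ X))
    step false false false = refl

  ─⊑∁ : ∀ {n} (Y S : Subset n) → (Y ─ S) ⊑ ∁ S
  ─⊑∁ []          []          = sub refl
  ─⊑∁ (_ ∷ Y)     (true ∷ S)  = sub (holds (─⊑∁ Y S))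
  ─⊑∁ (true ∷ Y)  (false ∷ S) = sub (holds (─⊑∁ Y S))
  ─⊑∁ (false ∷ Y) (false ∷ S) = sub (holds (─⊑∁ Y S))

  private
    there⁻ : ∀ {n b} {B : Subset n} {x} → Fin.suc x ∈ₛ (b ∷ B) → x ∈ₛ B
    there⁻ (there p) = p

  ⊆⇒⊑ : ∀ {n} {A B : Subset n} → A ⊆ B → A ⊑ B
  ⊆⇒⊑ {A = []} {[]} _ = sub refl
  ⊆⇒⊑ {A = false ∷ A} {b ∷ B} s = sub (holds (⊆⇒⊑ {A = A} (λ p → there⁻ (s (there p)))))
  ⊆⇒⊑ {A = true ∷ A} {true ∷ B} s = sub (holds (⊆⇒⊑ {A = A} (λ p → there⁻ (s (there p)))))
  ⊆⇒⊑ {A = true ∷ A} {false ∷ B} s with s here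
  ... | ()

  ⊑⇒⊆ : ∀ {n} {A B : Subset n} → A ⊑ B → A ⊆ B
  ⊑⇒⊆ {A = true ∷ A} {true ∷ B} e here = here
  ⊑⇒⊆ {A = true ∷ A} {false ∷ B} (sub ()) here
  ⊑⇒⊆ {A = a ∷ A} {b ∷ B} e (there x) = there (⊑⇒⊆ {A = A} (⊑-tail {a = a} e) x)

module Monomials where

  open Subsets
  open import Data.Nat as ℕ using (zero; suc; _+_; _≤_; _<_; z≤n; s≤s)
  import Data.Nat.Properties as NP
  open import Data.Bool using (Bool; true; false; if_then_else_)
  open import Data.Fin as Fin using (Fin)
  open import Data.Fin.Subset using (_∪_; _─_; ∁) renaming (⊤ to ⊤ₛ)
  open import Data.Fin.Subset.Properties using (_∈?_)
  open import Data.Vec as Vec using ([]; _∷_; replicate; tabulate)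
  import Data.Vec.Properties as VecP
  open import Data.Vec.Relation.Binary.Pointwise.Inductive as Pointwise using (Pointwise; []; _∷_)
  open import Data.List as List using (List; filter; allFin; foldr)
  import Data.List.Properties as ListP
  open import Data.Product using (Σ; _×_; _,_)
  open import Data.Sum using (_⊎_; inj₁; inj₂)
  open import Data.Unit using (tt) renaming (⊤ to Unit)
  open import Data.Empty using (⊥-elim)
  open import Relation.Nullary using (¬_; Dec; yes; no; does)
  open import Relation.Nullary.Decidable using (⌊_⌋)
  open import Relation.Binary.PropositionalEquality
  open import Relation.Binary.Definitions using (tri<; tri≈; tri>)

  infix 4 _≤ₘ_

  _≤ₘ_ : ∀ {n} → Mon n → Mon n → Set
  _≤ₘ_ = Pointwise _≤_

  ≤ₘ-dec : ∀ {n} (m M : Mon n) → Dec (m ≤ₘ M)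
  ≤ₘ-dec = Pointwise.decidable ℕ._≤?_

  ≤ₘ-refl : ∀ {n} {m : Mon n} → m ≤ₘ m
  ≤ₘ-refl = Pointwise.refl NP.≤-refl

  ≤ₘ-trans : ∀ {n} {a b c : Mon n} → a ≤ₘ b → b ≤ₘ c → a ≤ₘ c
  ≤ₘ-trans = Pointwise.trans NP.≤-trans

  ·ₘ-comm : ∀ {n} (a b : Mon n) → a ·ₘ b ≡ b ·ₘ a
  ·ₘ-comm = VecP.zipWith-comm NP.+-comm

  ·ₘ-identityˡ : ∀ {n} (m : Mon n) → oneₘ ·ₘ m ≡ m
  ·ₘ-identityˡ = VecP.zipWith-identityˡ NP.+-identityˡ

  ·ₘ-identityʳ : ∀ {n} (m : Mon n) → m ·ₘ oneₘ ≡ m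
  ·ₘ-identityʳ = VecP.zipWith-identityʳ NP.+-identityʳ

  one≤ₘ : ∀ {n} (m : Mon n) → oneₘ ≤ₘ m
  one≤ₘ []      = []
  one≤ₘ (_ ∷ m) = z≤n ∷ one≤ₘ m

  ≤ₘ⇒∣ₘ : ∀ {n} {m M : Mon n} → m ≤ₘ M → m ∣ₘ M
  ≤ₘ⇒∣ₘ [] = [] , refl
  ≤ₘ⇒∣ₘ {m = a ∷ _} {b ∷ _} (p ∷ ps) with ≤ₘ⇒∣ₘ ps
  ... | u , e = (b ℕ.∸ a) ∷ u , cong₂ _∷_ (NP.m∸n+n≡m p) e

  ≤ₘ-·ₘ : ∀ {n} (u m : Mon n) → m ≤ₘ (u ·ₘ m)
  ≤ₘ-·ₘ []      []      = []
  ≤ₘ-·ₘ (x ∷ u) (y ∷ m) = NP.m≤n+m y x ∷ ≤ₘ-·ₘ u m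

  ∣ₘ⇒≤ₘ : ∀ {n} {m M : Mon n} → m ∣ₘ M → m ≤ₘ M
  ∣ₘ⇒≤ₘ {m = m} (u , refl) = ≤ₘ-·ₘ u m

  ·ₘ-mono : ∀ {n} {a A b B : Mon n} → a ≤ₘ A → b ≤ₘ B → (a ·ₘ b) ≤ₘ (A ·ₘ B)
  ·ₘ-mono []       []       = []
  ·ₘ-mono (p ∷ ps) (q ∷ qs) = NP.+-mono-≤ p q ∷ ·ₘ-mono ps qs

  private
    +-cancel-≤ : ∀ {x X y Y} → x ≤ X → y ≤ Y → x + y ≡ X + Y → (x ≡ X) × (y ≡ Y)
    +-cancel-≤ {x} {X} {y} {Y} x≤X y≤Y e with NP.m≤n⇒m<n∨m≡n x≤X
    ... | inj₁ x<X  = ⊥-elim (NP.<-irrefl e (NP.+-mono-<-≤ x<X y≤Y))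
    ... | inj₂ refl = refl , NP.+-cancelˡ-≡ x y Y e

  -- If a ∣ A and b ∣ B then a·b = A·B forces a = A and b = B: the top (and
  -- bottom) monomial of a product arises only from the factors' tops.
  ·ₘ-cancel : ∀ {n} {a A b B : Mon n} → a ≤ₘ A → b ≤ₘ B → (a ·ₘ b) ≡ (A ·ₘ B) → (a ≡ A) × (b ≡ B)
  ·ₘ-cancel [] [] _ = refl , refl
  ·ₘ-cancel (p ∷ ps) (q ∷ qs) e
    with +-cancel-≤ p q (cong Vec.head e) | ·ₘ-cancel ps qs (cong Vec.tail e)
  ... | refl , refl | refl , refl = refl , refl

  𝐱 : ∀ {n} → Subset n → Mon n
  𝐱 []      = []
  𝐱 (b ∷ B) = (if b then 1 else 0) ∷ 𝐱 B

  positive : ℕ → Bool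
  positive zero    = false
  positive (suc _) = true

  supp : ∀ {n} → Mon n → Subset n
  supp []      = []
  supp (k ∷ m) = positive k ∷ supp m

  supp-𝐱 : ∀ {n} (W : Subset n) → supp (𝐱 W) ≡ W
  supp-𝐱 []          = refl
  supp-𝐱 (true ∷ W)  = cong (true ∷_) (supp-𝐱 W)
  supp-𝐱 (false ∷ W) = cong (false ∷_) (supp-𝐱 W)

  𝐱-supp : ∀ {n} {m : Mon n} → m ≤ₘ 𝐱 ⊤ₛ → 𝐱 (supp m) ≡ m
  𝐱-supp [] = refl
  𝐱-supp {m = zero ∷ m}          (_ ∷ ps) = cong (0 ∷_) (𝐱-supp ps)
  𝐱-supp {m = suc zero ∷ m}      (_ ∷ ps) = cong (1 ∷_) (𝐱-supp ps)
  𝐱-supp {m = suc (suc _) ∷ m}   (s≤s () ∷ _)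

  supp-·ₘ : ∀ {n} (a b : Mon n) → supp (a ·ₘ b) ≡ (supp a ∪ supp b)
  supp-·ₘ []            []      = refl
  supp-·ₘ (zero ∷ a)    (y ∷ b) = cong (positive y ∷_) (supp-·ₘ a b)
  supp-·ₘ (suc x ∷ a)   (y ∷ b) = cong (true ∷_) (supp-·ₘ a b)

  ≤𝐱⇒⊑ : ∀ {n} {m : Mon n} {W} → m ≤ₘ 𝐱 W → supp m ⊑ W
  ≤𝐱⇒⊑ {W = []} [] = sub refl
  ≤𝐱⇒⊑ {m = zero ∷ m}  {W = w ∷ W}     (_ ∷ ps) = sub (holds (≤𝐱⇒⊑ ps))
  ≤𝐱⇒⊑ {m = suc _ ∷ m} {W = true ∷ W}  (_ ∷ ps) = sub (holds (≤𝐱⇒⊑ ps))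
  ≤𝐱⇒⊑ {m = suc _ ∷ m} {W = false ∷ W} (() ∷ _)

  𝐱≤𝐱⊤ : ∀ {n} (W : Subset n) → 𝐱 W ≤ₘ 𝐱 ⊤ₛ
  𝐱≤𝐱⊤ []          = []
  𝐱≤𝐱⊤ (true ∷ W)  = NP.≤-refl ∷ 𝐱≤𝐱⊤ W
  𝐱≤𝐱⊤ (false ∷ W) = z≤n ∷ 𝐱≤𝐱⊤ W

  ≤𝐱∧supp≡⇒≡ : ∀ {n} {m : Mon n} {W} → m ≤ₘ 𝐱 W → supp m ≡ W → m ≡ 𝐱 W
  ≤𝐱∧supp≡⇒≡ {W = W} le refl = sym (𝐱-supp (≤ₘ-trans le (𝐱≤𝐱⊤ W)))

  ⊑⇒𝐱≤ : ∀ {n} {T : Subset n} {m : Mon n} → T ⊑ supp m → 𝐱 T ≤ₘ m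
  ⊑⇒𝐱≤ {T = []}       {[]}        _ = []
  ⊑⇒𝐱≤ {T = false ∷ T} {_ ∷ _}    s = z≤n ∷ ⊑⇒𝐱≤ (⊑-tail s)
  ⊑⇒𝐱≤ {T = true ∷ T} {suc _ ∷ _} s = s≤s z≤n ∷ ⊑⇒𝐱≤ (⊑-tail s)
  ⊑⇒𝐱≤ {T = true ∷ T} {zero ∷ _}  (sub ())

  𝐱-mono : ∀ {n} {A B : Subset n} → A ⊑ B → 𝐱 A ≤ₘ 𝐱 B
  𝐱-mono {B = B} s = ⊑⇒𝐱≤ (subst (_ ⊑_) (sym (supp-𝐱 B)) s)

  𝐱-mono⁻ : ∀ {n} {A B : Subset n} → 𝐱 A ≤ₘ 𝐱 B → A ⊑ B
  𝐱-mono⁻ {A = A} p = subst (_⊑ _) (supp-𝐱 A) (≤𝐱⇒⊑ p)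

  𝐱-split : ∀ {n} {H S : Subset n} → H ⊑ S → 𝐱 H ·ₘ 𝐱 (S ─ H) ≡ 𝐱 S
  𝐱-split {H = []}        {[]}        _ = refl
  𝐱-split {H = true ∷ H}  {true ∷ S}  s = cong (1 ∷_) (𝐱-split (⊑-tail s))
  𝐱-split {H = true ∷ H}  {false ∷ S} (sub ())
  𝐱-split {H = false ∷ H} {true ∷ S}  s = cong (1 ∷_) (𝐱-split (⊑-tail s))
  𝐱-split {H = false ∷ H} {false ∷ S} s = cong (0 ∷_) (𝐱-split (⊑-tail s))

  𝐱-split′ : ∀ {n} {S W : Subset n} → S ⊑ W → 𝐱 (W ─ S) ·ₘ 𝐱 S ≡ 𝐱 W
  𝐱-split′ {S = S} {W} s = trans (·ₘ-comm (𝐱 (W ─ S)) (𝐱 S)) (𝐱-split s)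

  𝐱-∁-split : ∀ {n} (S : Subset n) → 𝐱 (∁ S) ·ₘ 𝐱 S ≡ 𝐱 ⊤ₛ
  𝐱-∁-split []          = refl
  𝐱-∁-split (true ∷ S)  = cong (1 ∷_) (𝐱-∁-split S)
  𝐱-∁-split (false ∷ S) = cong (1 ∷_) (𝐱-∁-split S)

  𝐱-𝒬-split : ∀ {n} {H S B : Subset n} → H ⊑ S → B ⊑ ∁ S → 𝐱 ((H ∪ B) ─ S) ·ₘ 𝐱 H ≡ 𝐱 (H ∪ B)
  𝐱-𝒬-split {H = []} {[]} {[]} _ _ = refl
  𝐱-𝒬-split {H = true ∷ H}  {true ∷ S}  {false ∷ B} s t = cong (1 ∷_) (𝐱-𝒬-split (⊑-tail s) (⊑-tail t))
  𝐱-𝒬-split {H = false ∷ H} {true ∷ S}  {false ∷ B} s t = cong (0 ∷_) (𝐱-𝒬-split (⊑-tail s) (⊑-tail t))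
  𝐱-𝒬-split {H = _ ∷ H}     {true ∷ S}  {true ∷ B}  _ (sub ())
  𝐱-𝒬-split {H = true ∷ H}  {false ∷ S} {_ ∷ B}     (sub ()) _
  𝐱-𝒬-split {H = false ∷ H} {false ∷ S} {true ∷ B}  s t = cong (1 ∷_) (𝐱-𝒬-split (⊑-tail s) (⊑-tail t))
  𝐱-𝒬-split {H = false ∷ H} {false ∷ S} {false ∷ B} s t = cong (0 ∷_) (𝐱-𝒬-split (⊑-tail s) (⊑-tail t))

  varₘ-zero : ∀ {n} → varₘ {suc n} Fin.zero ≡ 1 ∷ oneₘ
  varₘ-zero {n} = cong (1 ∷_) (zeros n)
    where
    zeros : ∀ k → tabulate {n = k} (λ _ → 0) ≡ replicate k 0
    zeros zero    = refl
    zeros (suc k) = cong (0 ∷_) (zeros k)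

  varₘ-suc : ∀ {n} (i : Fin n) → varₘ {suc n} (Fin.suc i) ≡ 0 ∷ varₘ i
  varₘ-suc i = cong (0 ∷_) (VecP.tabulate-cong lemma)
    where
    lemma : ∀ j → (if ⌊ Fin.suc i Fin.≟ Fin.suc j ⌋ then 1 else 0) ≡ (if ⌊ i Fin.≟ j ⌋ then 1 else 0)
    lemma j with i Fin.≟ j
    ... | yes _ = refl
    ... | no _  = refl

  monOf : ∀ {n} → List (Fin n) → Mon n
  monOf = foldr (λ i acc → varₘ i ·ₘ acc) oneₘ

  private
    monOf-suc : ∀ {n} (l : List (Fin n)) → monOf {suc n} (List.map Fin.suc l) ≡ 0 ∷ monOf l
    monOf-suc List.[] = refl
    monOf-suc (i List.∷ l) rewrite varₘ-suc i | monOf-suc l = refl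

    filter-suc : ∀ {n} b (B : Subset n) (l : List (Fin n)) →
                 filter (_∈? (b ∷ B)) (List.map Fin.suc l) ≡ List.map Fin.suc (filter (_∈? B) l)
    filter-suc b B List.[] = refl
    filter-suc b B (i List.∷ l) with does (i ∈? B)
    ... | true  = cong (Fin.suc i List.∷_) (filter-suc b B l)
    ... | false = filter-suc b B l

    allFin-suc : ∀ n → List.tabulate {n = n} Fin.suc ≡ List.map Fin.suc (allFin n)
    allFin-suc n = sym (ListP.map-tabulate (λ i → i) Fin.suc)

  monOf-elements : ∀ {n} (B : Subset n) → monOf (filter (_∈? B) (allFin n)) ≡ 𝐱 B
  monOf-elements [] = refl
  monOf-elements {suc n} (true ∷ B) = begin
    varₘ Fin.zero ·ₘ monOf (filter (_∈? (true ∷ B)) (List.tabulate Fin.suc))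
      ≡⟨ cong₂ _·ₘ_ varₘ-zero (cong (λ l → monOf (filter (_∈? (true ∷ B)) l)) (allFin-suc n)) ⟩
    (1 ∷ oneₘ) ·ₘ monOf (filter (_∈? (true ∷ B)) (List.map Fin.suc (allFin n)))
      ≡⟨ cong (λ l → (1 ∷ oneₘ) ·ₘ monOf l) (filter-suc true B (allFin n)) ⟩
    (1 ∷ oneₘ) ·ₘ monOf (List.map Fin.suc (filter (_∈? B) (allFin n)))
      ≡⟨ cong ((1 ∷ oneₘ) ·ₘ_) (monOf-suc (filter (_∈? B) (allFin n))) ⟩
    1 ∷ (oneₘ ·ₘ monOf (filter (_∈? B) (allFin n)))
      ≡⟨ cong (1 ∷_) (trans (·ₘ-identityˡ _) (monOf-elements B)) ⟩
    1 ∷ 𝐱 B ∎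
    where open ≡-Reasoning
  monOf-elements {suc n} (false ∷ B) = begin
    monOf (filter (_∈? (false ∷ B)) (List.tabulate Fin.suc))
      ≡⟨ cong (λ l → monOf (filter (_∈? (false ∷ B)) l)) (allFin-suc n) ⟩
    monOf (filter (_∈? (false ∷ B)) (List.map Fin.suc (allFin n)))
      ≡⟨ cong monOf (filter-suc false B (allFin n)) ⟩
    monOf (List.map Fin.suc (filter (_∈? B) (allFin n)))
      ≡⟨ monOf-suc (filter (_∈? B) (allFin n)) ⟩
    0 ∷ monOf (filter (_∈? B) (allFin n))
      ≡⟨ cong (0 ∷_) (monOf-elements B) ⟩
    0 ∷ 𝐱 B ∎
    where open ≡-Reasoning

  square : ∀ {n} → Fin n → Mon n
  square i = varₘ i ·ₘ varₘ i

  square-divides : ∀ {n} (m : Mon n) → ¬ (m ≤ₘ 𝐱 ⊤ₛ) → Σ (Fin n) λ i → square i ≤ₘ m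
  square-divides [] ¬p = ⊥-elim (¬p [])
  square-divides {suc n} (a ∷ m) ¬p with a ℕ.≤? 1
  ... | no a≰1 = Fin.zero , subst (λ z → (z ·ₘ z) ≤ₘ (a ∷ m)) (sym varₘ-zero)
                   (NP.≰⇒> a≰1 ∷ subst (_≤ₘ m) (sym (·ₘ-identityˡ oneₘ)) (one≤ₘ m))
  ... | yes a≤1 with square-divides m (λ q → ¬p (a≤1 ∷ q))
  ...   | i , q = Fin.suc i , subst (λ z → (z ·ₘ z) ≤ₘ (a ∷ m)) (sym (varₘ-suc i)) (z≤n ∷ q)

  square-not-squarefree : ∀ {n} (i : Fin n) → ¬ (square i ≤ₘ 𝐱 ⊤ₛ)
  square-not-squarefree {suc n} Fin.zero p with Pointwise.head (subst (λ z → (z ·ₘ z) ≤ₘ 𝐱 ⊤ₛ) varₘ-zero p)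
  ... | s≤s ()
  square-not-squarefree {suc n} (Fin.suc i) p =
    square-not-squarefree i (Pointwise.tail (subst (λ z → (z ·ₘ z) ≤ₘ 𝐱 ⊤ₛ) (varₘ-suc i) p))

  varₘ≢square : ∀ {n} (i : Fin n) → varₘ i ≢ square i
  varₘ≢square {suc n} Fin.zero e with cong Vec.head (subst (λ z → z ≡ z ·ₘ z) varₘ-zero e)
  ... | ()
  varₘ≢square {suc n} (Fin.suc i) e = varₘ≢square i (cong Vec.tail (subst (λ z → z ≡ z ·ₘ z) (varₘ-suc i) e))

  oneₘ≢varₘ : ∀ {n} (i : Fin n) → oneₘ ≢ varₘ i
  oneₘ≢varₘ {suc n} Fin.zero e with cong Vec.head (subst (oneₘ ≡_) varₘ-zero e)
  ... | ()
  oneₘ≢varₘ {suc n} (Fin.suc i) e = oneₘ≢varₘ i (cong Vec.tail (subst (oneₘ ≡_) (varₘ-suc i) e))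

  _≼lex_ : ∀ {n} → Mon n → Mon n → Set
  []       ≼lex []       = Unit
  (x ∷ xs) ≼lex (y ∷ ys) = (x < y) ⊎ ((x ≡ y) × (xs ≼lex ys))

  private
    ≼lex-refl : ∀ {n} (m : Mon n) → m ≼lex m
    ≼lex-refl []      = tt
    ≼lex-refl (x ∷ m) = inj₂ (refl , ≼lex-refl m)

    ≼lex-antisym : ∀ {n} {m m' : Mon n} → m ≼lex m' → m' ≼lex m → m ≡ m'
    ≼lex-antisym {m = []} {[]} _ _ = refl
    ≼lex-antisym {m = _ ∷ _} {_ ∷ _} (inj₁ p)        (inj₁ q)        = ⊥-elim (NP.<-asym p q)
    ≼lex-antisym {m = _ ∷ _} {_ ∷ _} (inj₁ p)        (inj₂ (q , _))  = ⊥-elim (NP.<-irrefl (sym q) p)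
    ≼lex-antisym {m = _ ∷ _} {_ ∷ _} (inj₂ (p , _))  (inj₁ q)        = ⊥-elim (NP.<-irrefl (sym p) q)
    ≼lex-antisym {m = _ ∷ _} {_ ∷ _} (inj₂ (p , p')) (inj₂ (_ , q')) = cong₂ _∷_ p (≼lex-antisym p' q')

    ≼lex-trans : ∀ {n} {a b c : Mon n} → a ≼lex b → b ≼lex c → a ≼lex c
    ≼lex-trans {a = []} {[]} {[]} _ _ = tt
    ≼lex-trans {a = _ ∷ _} {_ ∷ _} {_ ∷ _} (inj₁ p)           (inj₁ q)           = inj₁ (NP.<-trans p q)
    ≼lex-trans {a = _ ∷ _} {_ ∷ _} {_ ∷ _} (inj₁ p)           (inj₂ (refl , _))  = inj₁ p
    ≼lex-trans {a = _ ∷ _} {_ ∷ _} {_ ∷ _} (inj₂ (refl , _))  (inj₁ q)           = inj₁ q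
    ≼lex-trans {a = _ ∷ _} {_ ∷ _} {_ ∷ _} (inj₂ (refl , p))  (inj₂ (refl , q))  = inj₂ (refl , ≼lex-trans p q)

    ≼lex-total : ∀ {n} (m m' : Mon n) → (m ≼lex m') ⊎ (m' ≼lex m)
    ≼lex-total [] [] = inj₁ tt
    ≼lex-total (x ∷ m) (y ∷ m') with NP.<-cmp x y
    ... | tri< x<y _ _ = inj₁ (inj₁ x<y)
    ... | tri> _ _ y<x = inj₂ (inj₁ y<x)
    ... | tri≈ _ refl _ with ≼lex-total m m'
    ...   | inj₁ p = inj₁ (inj₂ (refl , p))
    ...   | inj₂ p = inj₂ (inj₂ (refl , p))

    oneₘ≼lex : ∀ {n} (m : Mon n) → oneₘ ≼lex m
    oneₘ≼lex []          = tt
    oneₘ≼lex (zero ∷ m)  = inj₂ (refl , oneₘ≼lex m)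
    oneₘ≼lex (suc _ ∷ m) = inj₁ (s≤s z≤n)

    ≼lex-compat : ∀ {n} {m m' : Mon n} u → m ≼lex m' → (u ·ₘ m) ≼lex (u ·ₘ m')
    ≼lex-compat {m = []} {[]} [] _ = tt
    ≼lex-compat {m = _ ∷ _} {_ ∷ _} (k ∷ u) (inj₁ p)          = inj₁ (NP.+-monoʳ-< k p)
    ≼lex-compat {m = _ ∷ _} {_ ∷ _} (k ∷ u) (inj₂ (refl , p)) = inj₂ (refl , ≼lex-compat u p)

  lexOrder : ∀ n → TermOrder n
  lexOrder n = record
    { _≼_      = _≼lex_
    ; refl≼    = ≼lex-refl
    ; antisym≼ = ≼lex-antisym
    ; trans≼   = ≼lex-trans
    ; total≼   = ≼lex-total
    ; one-min  = oneₘ≼lex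
    ; compat   = ≼lex-compat
    }

module SetFamilies where

  open Subsets
  open import Data.Nat using (zero; suc; _+_)
  import Data.Nat.Properties as NP
  open import Data.Bool using (Bool; true; false; _∨_)
  open import Data.Fin as Fin using (Fin)
  open import Data.Fin.Subset using (_∪_; _─_; ∁)
  open import Data.Fin.Subset.Properties using (_⊆?_; _∈?_)
  open import Data.Vec as Vec using ([]; _∷_)
  open import Data.List as List using (List; []; _∷_; map; filter; lookup)
  open import Data.List.Membership.Propositional.Properties
  open import Data.List.Relation.Unary.Any using (here)
  open import Data.List.Relation.Unary.All as All using ([]; _∷_)
  open import Data.List.Relation.Unary.AllPairs using ([]; _∷_)
  open import Data.List.Relation.Unary.Unique.Propositional using (Unique)
  import Data.List.Relation.Unary.Unique.Propositional.Properties as UniqueP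
  open import Data.Product using (Σ; _×_; _,_; proj₂)
  open import Data.Empty using (⊥-elim)
  open import Relation.Nullary using (¬_; ¬?; does)
  open import Relation.Unary using (Decidable)
  open import Relation.Binary.PropositionalEquality

  bit : ∀ {n} → Fin n → Subset n → Bool
  bit i X = does (i ∈? X)

  allSubsets-complete : ∀ {n} (X : Subset n) → X ∈ allSubsets n
  allSubsets-complete [] = here refl
  allSubsets-complete {suc n} (true ∷ X)  = ∈-++⁺ˡ (∈-map⁺ (true ∷_) (allSubsets-complete X))
  allSubsets-complete {suc n} (false ∷ X) =
    ∈-++⁺ʳ (map (true ∷_) (allSubsets n)) (∈-map⁺ (false ∷_) (allSubsets-complete X))

  allSubsets-unique : ∀ n → Unique (allSubsets n)
  allSubsets-unique zero    = [] ∷ []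
  allSubsets-unique (suc n) =
    UniqueP.++⁺ (UniqueP.map⁺ (cong Vec.tail) (allSubsets-unique n))
                (UniqueP.map⁺ (cong Vec.tail) (allSubsets-unique n)) disjoint
    where
    disjoint : ∀ {v} → ¬ ((v ∈ map (true ∷_) (allSubsets n)) × (v ∈ map (false ∷_) (allSubsets n)))
    disjoint (a , b) with ∈-map⁻ (true ∷_) a | ∈-map⁻ (false ∷_) b
    ... | _ , _ , refl | _ , _ , ()

  lookup-injective : ∀ {a} {A : Set a} {xs : List A} → Unique xs → ∀ i j → lookup xs i ≡ lookup xs j → i ≡ j
  lookup-injective {xs = _ ∷ _}  _       Fin.zero    Fin.zero    _ = refl
  lookup-injective {xs = _ ∷ xs} (h ∷ _) Fin.zero    (Fin.suc j) e = ⊥-elim (All.lookup h (∈-lookup {xs = xs} j) e)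
  lookup-injective {xs = _ ∷ xs} (h ∷ _) (Fin.suc i) Fin.zero    e = ⊥-elim (All.lookup h (∈-lookup {xs = xs} i) (sym e))
  lookup-injective {xs = _ ∷ _}  (_ ∷ u) (Fin.suc i) (Fin.suc j) e = cong Fin.suc (lookup-injective u i j e)

  length-complement : ∀ {a p} {A : Set a} {P : A → Set p} (P? : Decidable P) (xs : List A) →
    List.length (filter (λ x → ¬? (P? x)) xs) + List.length (filter P? xs) ≡ List.length xs
  length-complement P? [] = refl
  length-complement P? (x ∷ xs) with does (P? x)
  ... | true  = trans (NP.+-suc _ _) (cong suc (length-complement P? xs))
  ... | false = cong suc (length-complement P? xs)

  private
    ∪-─ : ∀ {n} {S X : Subset n} → S ⊑ X → (S ∪ (X ─ S)) ≡ X
    ∪-─ {S = []} {[]} _ = refl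
    ∪-─ {S = true ∷ S}  {true ∷ X}  s = cong (true ∷_) (∪-─ (⊑-tail s))
    ∪-─ {S = true ∷ S}  {false ∷ X} (sub ())
    ∪-─ {S = false ∷ S} {true ∷ X}  s = cong (true ∷_) (∪-─ (⊑-tail s))
    ∪-─ {S = false ∷ S} {false ∷ X} s = cong (false ∷_) (∪-─ (⊑-tail s))

    ⊑-∪ˡ : ∀ {n} (S B : Subset n) → S ⊑ (S ∪ B)
    ⊑-∪ˡ []          []      = sub refl
    ⊑-∪ˡ (true ∷ S)  (_ ∷ B) = sub (holds (⊑-∪ˡ S B))
    ⊑-∪ˡ (false ∷ S) (_ ∷ B) = sub (holds (⊑-∪ˡ S B))

    ─∈complements : ∀ {n} (X S : Subset n) → (X ─ S) ∈ filter (λ B → B ⊆? ∁ S) (allSubsets n)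
    ─∈complements X S = ∈-filter⁺ (λ B → B ⊆? ∁ S) (allSubsets-complete (X ─ S)) (⊑⇒⊆ (─⊑∁ X S))

  𝒫-intro : ∀ {n} {S X : Subset n} → S ⊑ X → X ∈ 𝒫 S
  𝒫-intro {S = S} {X} s = subst (_∈ 𝒫 S) (∪-─ s) (∈-map⁺ (S ∪_) (─∈complements X S))

  𝒫-elim : ∀ {n} {S X : Subset n} → X ∈ 𝒫 S → S ⊑ X
  𝒫-elim {S = S} m with ∈-map⁻ (S ∪_) m
  ... | B , _ , refl = ⊑-∪ˡ S B

  𝒬-elim : ∀ {n} {S H Y : Subset n} → Y ∈ 𝒬 S H → Σ (Subset n) λ B → (Y ≡ (H ∪ B)) × B ⊑ ∁ S
  𝒬-elim {n} {S} {H} m with ∈-map⁻ (H ∪_) m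
  ... | B , B∈ , e = B , e , ⊆⇒⊑ (proj₂ (∈-filter⁻ (λ B → B ⊆? ∁ S) {xs = allSubsets n} B∈))

  private
    decompose : ∀ {n} {S H X : Subset n} → H ⊑ S → (∀ i → bit i H ≡ true → bit i X ≡ true) →
                (∀ i → bit i (S ─ H) ≡ true → bit i X ≡ false) → X ≡ (H ∪ (X ─ S))
    decompose {S = []} {[]} {[]} _ _ _ = refl
    decompose {S = s ∷ S} {h ∷ H} {x ∷ X} H⊑S inH outSH =
      cong₂ _∷_ (first s h x H⊑S (inH Fin.zero) (outSH Fin.zero))
                (decompose (⊑-tail H⊑S) (λ i → inH (Fin.suc i)) (λ i → outSH (Fin.suc i)))
      where
      first : ∀ s h x → (h ∷ H) ⊑ (s ∷ S) → (bit Fin.zero (h ∷ H) ≡ true → bit Fin.zero (x ∷ X) ≡ true) →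
              (bit Fin.zero ((s ∷ S) ─ (h ∷ H)) ≡ true → bit Fin.zero (x ∷ X) ≡ false) →
              x ≡ (h ∨ Vec.head ((x ∷ X) ─ (s ∷ S)))
      first true  true  true  _ _ _ = refl
      first true  true  false _ f _ with f refl
      ... | ()
      first true  false true  _ _ g with g refl
      ... | ()
      first true  false false _ _ _ = refl
      first false true  _     (sub ()) _ _
      first false false true  _ _ _ = refl
      first false false false _ _ _ = refl

  𝒬-intro : ∀ {n} {S H X : Subset n} → H ⊑ S → (∀ i → bit i H ≡ true → bit i X ≡ true) →
            (∀ i → bit i (S ─ H) ≡ true → bit i X ≡ false) → X ∈ 𝒬 S H
  𝒬-intro {S = S} {H} {X} H⊑S inH outSH =
    subst (_∈ 𝒬 S H) (sym (decompose H⊑S inH outSH)) (∈-map⁺ (H ∪_) (─∈complements X S))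

module FieldFacts {c ℓ} (F : Field c ℓ) where

  open Field F
  open import Relation.Nullary using (¬_)
  open import Data.Product using (_,_)
  open import Relation.Binary.Reasoning.Setoid setoid
  open import Algebra.Properties.Ring ring public
    using (-‿distribˡ-*; -‿distribʳ-*; -‿involutive; -0#≈0#; -‿+-comm; +-inverseʳ-unique)
  open import Algebra.Properties.CommutativeSemigroup *-commutativeSemigroup public
    using () renaming (interchange to *-interchange; x∙yz≈y∙xz to *-exchange)

  *-nonzero : ∀ {x y} → ¬ (x ≈ 0#) → ¬ (y ≈ 0#) → ¬ (x * y ≈ 0#)
  *-nonzero {x} {y} x≉0 y≉0 xy≈0 with inverse x x≉0 | inverse y y≉0
  ... | x' , xx'≈1 | y' , yy'≈1 = 0≉1 (begin
    0#                  ≈⟨ zeroˡ (x' * y') ⟨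
    0# * (x' * y')      ≈⟨ *-congʳ xy≈0 ⟨
    (x * y) * (x' * y') ≈⟨ *-interchange x y x' y' ⟩
    (x * x') * (y * y') ≈⟨ *-cong xx'≈1 yy'≈1 ⟩
    1# * 1#             ≈⟨ *-identityˡ 1# ⟩
    1#                  ∎)

  -- Signs: elements with u² = 1.  Extreme coefficients of the generators
  -- are products of ±1, hence signs, hence nonzero.
  Sign : Carrier → Set ℓ
  Sign u = u * u ≈ 1#

  sign-1 : Sign 1#
  sign-1 = *-identityˡ 1#

  sign-−1 : Sign (- 1#)
  sign-−1 = begin
    - 1# * - 1#   ≈⟨ -‿distribˡ-* 1# (- 1#) ⟨
    - (1# * - 1#) ≈⟨ -‿cong (*-identityˡ (- 1#)) ⟩
    - (- 1#)      ≈⟨ -‿involutive 1# ⟩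
    1#            ∎

  sign-* : ∀ {u v} → Sign u → Sign v → Sign (u * v)
  sign-* {u} {v} u²≈1 v²≈1 = begin
    (u * v) * (u * v) ≈⟨ *-interchange u v u v ⟩
    (u * u) * (v * v) ≈⟨ *-cong u²≈1 v²≈1 ⟩
    1# * 1#           ≈⟨ *-identityˡ 1# ⟩
    1#                ∎

  sign-nonzero : ∀ {u} → Sign u → ¬ (u ≈ 0#)
  sign-nonzero {u} u²≈1 u≈0 = 0≉1 (begin
    0#     ≈⟨ zeroˡ u ⟨
    0# * u ≈⟨ *-congʳ u≈0 ⟨
    u * u  ≈⟨ u²≈1 ⟩
    1#     ∎)

module Polynomials {c ℓ} (F : Field c ℓ) (n : ℕ) where

  open Subsets
  open Monomials
  open SetFamilies using (bit)
  open FieldFacts F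
  open import Data.Nat as ℕ using (suc)
  import Data.Nat.Properties as NP
  open import Data.Bool using (Bool; true; false; if_then_else_; _∧_)
  open import Data.Fin as Fin using (Fin)
  open import Data.Fin.Subset using (_─_)
  open import Data.Fin.Subset.Properties using (_∈?_)
  open import Data.Vec using ([]; _∷_; replicate)
  open import Data.List as List using (List; []; _∷_; _++_; map; filter; allFin)
  import Data.List.Properties as ListP
  open import Data.List.Relation.Unary.All as All using (All; []; _∷_)
  import Data.List.Relation.Unary.All.Properties as AllP
  open import Data.List.Relation.Unary.Any using (Any; here; there)
  import Data.List.Relation.Unary.Any as Any
  open import Data.Product using (Σ; _×_; _,_; proj₁; proj₂)
  open import Data.Sum using (inj₁; inj₂)
  open import Data.Empty using (⊥-elim)
  open import Relation.Nullary using (¬_; Dec; yes; no; ¬?)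
  open import Relation.Binary.PropositionalEquality as ≡ using (_≢_)

  open Field F
  open Poly F n
  open import Relation.Binary.Reasoning.Setoid setoid

  ext : (Mon n → Carrier) → Pol → Carrier
  ext φ []            = 0#
  ext φ ((a , m) ∷ p) = a * φ m + ext φ p

  ext-++ : ∀ φ p q → ext φ (p ++ q) ≈ ext φ p + ext φ q
  ext-++ φ []            q = sym (+-identityˡ _)
  ext-++ φ ((a , m) ∷ p) q = trans (+-congˡ (ext-++ φ p q)) (sym (+-assoc _ _ _))

  ext-neg : ∀ φ p → ext φ (-ₚ p) ≈ - ext φ p
  ext-neg φ []            = sym -0#≈0#
  ext-neg φ ((a , m) ∷ p) = begin
    - a * φ m + ext φ (-ₚ p)  ≈⟨ +-cong (sym (-‿distribˡ-* a (φ m))) (ext-neg φ p) ⟩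
    - (a * φ m) + - ext φ p   ≈⟨ -‿+-comm _ _ ⟩
    - (a * φ m + ext φ p)     ∎

  ext-congᴬ : ∀ {φ ψ} p → All (λ am → φ (proj₂ am) ≈ ψ (proj₂ am)) p → ext φ p ≈ ext ψ p
  ext-congᴬ []            []       = refl
  ext-congᴬ ((a , m) ∷ p) (e ∷ es) = +-cong (*-congˡ e) (ext-congᴬ p es)

  ext-cong : ∀ {φ ψ} → (∀ m → φ m ≈ ψ m) → ∀ p → ext φ p ≈ ext ψ p
  ext-cong e []            = refl
  ext-cong e ((a , m) ∷ p) = +-cong (*-congˡ (e m)) (ext-cong e p)

  ext-scaleˡ : ∀ (k : Carrier) φ p → ext (λ m → k * φ m) p ≈ k * ext φ p
  ext-scaleˡ k φ []            = sym (zeroʳ k)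
  ext-scaleˡ k φ ((a , m) ∷ p) = begin
    a * (k * φ m) + ext (λ m → k * φ m) p ≈⟨ +-cong (*-exchange a k (φ m)) (ext-scaleˡ k φ p) ⟩
    k * (a * φ m) + k * ext φ p           ≈⟨ distribˡ k _ _ ⟨
    k * (a * φ m + ext φ p)               ∎

  ext-scaleʳ : ∀ (k : Carrier) φ p → ext (λ m → φ m * k) p ≈ ext φ p * k
  ext-scaleʳ k φ p = trans (ext-cong (λ m → *-comm (φ m) k) p) (trans (ext-scaleˡ k φ p) (*-comm k _))

  private
    ext-monomial-multiple : ∀ φ (a : Carrier) (u : Mon n) q →
      ext φ (map (λ bm → (a * proj₁ bm , u ·ₘ proj₂ bm)) q) ≈ a * ext (λ m → φ (u ·ₘ m)) q
    ext-monomial-multiple φ a u []            = sym (zeroʳ a)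
    ext-monomial-multiple φ a u ((b , m) ∷ q) = begin
      (a * b) * φ (u ·ₘ m) + ext φ (map _ q)               ≈⟨ +-cong (*-assoc a b _) (ext-monomial-multiple φ a u q) ⟩
      a * (b * φ (u ·ₘ m)) + a * ext (λ m → φ (u ·ₘ m)) q ≈⟨ distribˡ a _ _ ⟨
      a * (b * φ (u ·ₘ m) + ext (λ m → φ (u ·ₘ m)) q)     ∎

  ext-* : ∀ φ p q → ext φ (p *ₚ q) ≈ ext (λ m₁ → ext (λ m₂ → φ (m₁ ·ₘ m₂)) q) p
  ext-* φ []            q = refl
  ext-* φ ((a , m) ∷ p) q = begin
    ext φ (map _ q ++ (p *ₚ q))                     ≈⟨ ext-++ φ (map _ q) (p *ₚ q) ⟩
    ext φ (map _ q) + ext φ (p *ₚ q)                ≈⟨ +-cong (ext-monomial-multiple φ a m q) (ext-* φ p q) ⟩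
    a * ext (λ m₂ → φ (m ·ₘ m₂)) q + ext (λ m₁ → ext (λ m₂ → φ (m₁ ·ₘ m₂)) q) p ∎

  δ : Mon n → Mon n → Carrier
  δ m m' with m' ≟ₘ m
  ... | yes _ = 1#
  ... | no  _ = 0#

  δ-same : ∀ m → δ m m ≈ 1#
  δ-same m with m ≟ₘ m
  ... | yes _ = refl
  ... | no ne = ⊥-elim (ne ≡.refl)

  δ-diff : ∀ {m m'} → m' ≢ m → δ m m' ≈ 0#
  δ-diff {m} {m'} ne with m' ≟ₘ m
  ... | yes e = ⊥-elim (ne e)
  ... | no _  = refl

  coeff≈ext-δ : ∀ p m → coeff p m ≈ ext (δ m) p
  coeff≈ext-δ []             m = refl
  coeff≈ext-δ ((a , m') ∷ p) m with m' ≟ₘ m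
  ... | yes _ = +-cong (sym (*-identityʳ a)) (coeff≈ext-δ p m)
  ... | no _  = trans (sym (+-identityˡ _)) (+-cong (sym (zeroʳ a)) (coeff≈ext-δ p m))

  coeff-++ : ∀ p q m → coeff (p ++ q) m ≈ coeff p m + coeff q m
  coeff-++ p q m = begin
    coeff (p ++ q) m              ≈⟨ coeff≈ext-δ (p ++ q) m ⟩
    ext (δ m) (p ++ q)            ≈⟨ ext-++ (δ m) p q ⟩
    ext (δ m) p + ext (δ m) q     ≈⟨ +-cong (coeff≈ext-δ p m) (coeff≈ext-δ q m) ⟨
    coeff p m + coeff q m         ∎

  coeff-neg : ∀ p m → coeff (-ₚ p) m ≈ - coeff p m
  coeff-neg p m = trans (coeff≈ext-δ (-ₚ p) m) (trans (ext-neg (δ m) p) (-‿cong (sym (coeff≈ext-δ p m))))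

  coeff-absent : ∀ p m → All (λ am → proj₂ am ≢ m) p → coeff p m ≈ 0#
  coeff-absent []             m []         = refl
  coeff-absent ((a , m') ∷ p) m (ne ∷ nes) with m' ≟ₘ m
  ... | yes e = ⊥-elim (ne e)
  ... | no _  = coeff-absent p m nes

  coeff-single : ∀ a m → coeff ((a , m) ∷ []) m ≈ a
  coeff-single a m with m ≟ₘ m
  ... | yes _ = +-identityʳ a
  ... | no ne = ⊥-elim (ne ≡.refl)

  without : Mon n → Pol → Pol
  without m = filter (λ am → ¬? (proj₂ am ≟ₘ m))

  private
    ext-split : ∀ φ m p → ext φ p ≈ coeff p m * φ m + ext φ (without m p)
    ext-split φ m [] = sym (trans (+-congʳ (zeroˡ (φ m))) (+-identityˡ 0#))
    ext-split φ m ((a , m') ∷ p) with m' ≟ₘ m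
    ... | yes ≡.refl = begin
      a * φ m' + ext φ p                                          ≈⟨ +-congˡ (ext-split φ m' p) ⟩
      a * φ m' + (coeff p m' * φ m' + ext φ (without m' p))       ≈⟨ +-assoc _ _ _ ⟨
      (a * φ m' + coeff p m' * φ m') + ext φ (without m' p)       ≈⟨ +-congʳ (distribʳ (φ m') a _) ⟨
      (a + coeff p m') * φ m' + ext φ (without m' p)              ∎
    ... | no _ = begin
      a * φ m' + ext φ p                                          ≈⟨ +-congˡ (ext-split φ m p) ⟩
      a * φ m' + (coeff p m * φ m + ext φ (without m p))          ≈⟨ +-assoc _ _ _ ⟨
      (a * φ m' + coeff p m * φ m) + ext φ (without m p)          ≈⟨ +-congʳ (+-comm _ _) ⟩
      (coeff p m * φ m + a * φ m') + ext φ (without m p)          ≈⟨ +-assoc _ _ _ ⟩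
      coeff p m * φ m + (a * φ m' + ext φ (without m p))          ∎

    coeff-without-same : ∀ m p → coeff (without m p) m ≈ 0#
    coeff-without-same m [] = refl
    coeff-without-same m ((a , m') ∷ p) with m' ≟ₘ m
    ... | yes _ = coeff-without-same m p
    ... | no ne with m' ≟ₘ m
    ...   | yes e = ⊥-elim (ne e)
    ...   | no _  = coeff-without-same m p

    coeff-without-other : ∀ {m m'} p → m' ≢ m → coeff (without m p) m' ≈ coeff p m'
    coeff-without-other [] ne = refl
    coeff-without-other {m} {m'} ((a , m'') ∷ p) ne with m'' ≟ₘ m
    ... | yes ≡.refl with m ≟ₘ m'
    ...   | yes e = ⊥-elim (ne (≡.sym e))
    ...   | no _  = coeff-without-other p ne
    coeff-without-other {m} {m'} ((a , m'') ∷ p) ne | no _ with m'' ≟ₘ m'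
    ...   | yes _ = +-congˡ (coeff-without-other p ne)
    ...   | no _  = coeff-without-other p ne

    length-without : ∀ a m p → List.length (without m ((a , m) ∷ p)) ℕ.≤ List.length p
    length-without a m p with m ≟ₘ m
    ... | yes _ = ListP.length-filter (λ am → ¬? (proj₂ am ≟ₘ m)) p
    ... | no ne = ⊥-elim (ne ≡.refl)

    isolation′ : ∀ φ m₀ k p → List.length p ℕ.< k → (∀ m → m ≢ m₀ → coeff p m * φ m ≈ 0#) →
                 ext φ p ≈ coeff p m₀ * φ m₀
    isolation′ φ m₀ (suc k) [] _ _ = sym (zeroˡ (φ m₀))
    isolation′ φ m₀ (suc k) p@((a , m₁) ∷ p′) (ℕ.s≤s len<k) vanish = begin
      ext φ p                                    ≈⟨ ext-split φ m₁ p ⟩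
      coeff p m₁ * φ m₁ + ext φ q                ≈⟨ +-congˡ (isolation′ φ m₀ k q (NP.≤-trans (ℕ.s≤s (length-without a m₁ p′)) len<k) vanish-q) ⟩
      coeff p m₁ * φ m₁ + coeff q m₀ * φ m₀      ≈⟨ last (m₁ ≟ₘ m₀) ⟩
      coeff p m₀ * φ m₀                          ∎
      where
      q = without m₁ p
      vanish-q : ∀ m → m ≢ m₀ → coeff q m * φ m ≈ 0#
      vanish-q m m≢m₀ with m ≟ₘ m₁
      ... | yes ≡.refl = trans (*-congʳ (coeff-without-same m p)) (zeroˡ _)
      ... | no m≢m₁    = trans (*-congʳ (coeff-without-other p m≢m₁)) (vanish m m≢m₀)
      last : Dec (m₁ ≡ m₀) → coeff p m₁ * φ m₁ + coeff q m₀ * φ m₀ ≈ coeff p m₀ * φ m₀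
      last (yes ≡.refl) = trans (+-congˡ (trans (*-congʳ (coeff-without-same m₁ p)) (zeroˡ _))) (+-identityʳ _)
      last (no m₁≢m₀)   = trans (+-cong (vanish m₁ m₁≢m₀) (*-congʳ (coeff-without-other p (λ e → m₁≢m₀ (≡.sym e)))))
                                (+-identityˡ _)

  isolation : ∀ φ m₀ p → (∀ m → m ≢ m₀ → coeff p m * φ m ≈ 0#) → ext φ p ≈ coeff p m₀ * φ m₀
  isolation φ m₀ p = isolation′ φ m₀ (suc (List.length p)) p NP.≤-refl

  ext-resp-≈ₚ : ∀ φ {p q} → p ≈ₚ q → ext φ p ≈ ext φ q
  ext-resp-≈ₚ φ {p} {q} p≈q = x∙y⁻¹≈ε⇒x≈y _ _ (begin
    ext φ p + - ext φ q           ≈⟨ +-congˡ (ext-neg φ q) ⟨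
    ext φ p + ext φ (-ₚ q)        ≈⟨ ext-++ φ p (-ₚ q) ⟨
    ext φ (p -ₚ q)                ≈⟨ isolation φ oneₘ (p -ₚ q) (λ m _ → trans (*-congʳ (difference-vanishes m)) (zeroˡ _)) ⟩
    coeff (p -ₚ q) oneₘ * φ oneₘ  ≈⟨ trans (*-congʳ (difference-vanishes oneₘ)) (zeroˡ _) ⟩
    0#                            ∎)
    where
    open import Algebra.Properties.Group +-group using (x∙y⁻¹≈ε⇒x≈y)
    difference-vanishes : ∀ m → coeff (p -ₚ q) m ≈ 0#
    difference-vanishes m = begin
      coeff (p -ₚ q) m           ≈⟨ coeff-++ p (-ₚ q) m ⟩
      coeff p m + coeff (-ₚ q) m ≈⟨ +-cong (p≈q m) (coeff-neg q m) ⟩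
      coeff q m + - coeff q m    ≈⟨ -‿inverseʳ _ ⟩
      0#                         ∎

  InRange : Mon n → Mon n → Carrier × Mon n → Set
  InRange lo hi am = (lo ≤ₘ proj₂ am) × (proj₂ am ≤ₘ hi)

  record Within (lo hi : Mon n) (p : Pol) : Set c where
    constructor within
    field terms : All (InRange lo hi) p

  Within-++ : ∀ {lo hi p q} → Within lo hi p → Within lo hi q → Within lo hi (p ++ q)
  Within-++ (within a) (within b) = within (AllP.++⁺ a b)

  Within-neg : ∀ {lo hi p} → Within lo hi p → Within lo hi (-ₚ p)
  Within-neg (within a) = within (AllP.map⁺ (All.map (λ r → r) a))

  Within-weaken : ∀ {lo hi lo' hi' p} → lo' ≤ₘ lo → hi ≤ₘ hi' → Within lo hi p → Within lo' hi' p
  Within-weaken l h (within a) = within (All.map (λ { (x , y) → ≤ₘ-trans l x , ≤ₘ-trans y h }) a)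

  Within-subst : ∀ {lo hi lo' hi' p} → lo ≡ lo' → hi ≡ hi' → Within lo hi p → Within lo' hi' p
  Within-subst ≡.refl ≡.refl b = b

  Within-* : ∀ {a A b B p q} → Within a A p → Within b B q → Within (a ·ₘ b) (A ·ₘ B) (p *ₚ q)
  Within-* {a} {A} {b} {B} {p} {q} (within bp) (within bq) = within (go bp)
    where
    inner : ∀ {x m} → InRange a A (x , m) →
            All (InRange (a ·ₘ b) (A ·ₘ B)) (map (λ bm → (x * proj₁ bm , m ·ₘ proj₂ bm)) q)
    inner (l , h) = AllP.map⁺ (All.map (λ { (l' , h') → ·ₘ-mono l l' , ·ₘ-mono h h' }) bq)
    go : ∀ {p} → All (InRange a A) p → All (InRange (a ·ₘ b) (A ·ₘ B)) (p *ₚ q)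
    go []          = []
    go (r ∷ bp′)   = AllP.++⁺ (inner r) (go bp′)

  coeff-above : ∀ {lo hi p m} → Within lo hi p → ¬ (m ≤ₘ hi) → coeff p m ≈ 0#
  coeff-above {p = p} {m} (within b) m≰hi = coeff-absent p m (All.map (λ { (_ , h) ≡.refl → m≰hi h }) b)

  coeff-below : ∀ {lo hi p m} → Within lo hi p → ¬ (lo ≤ₘ m) → coeff p m ≈ 0#
  coeff-below {p = p} {m} (within b) lo≰m = coeff-absent p m (All.map (λ { (l , _) ≡.refl → lo≰m l }) b)

  private
    coeff-*-unique : ∀ (P Q : Mon n → Set) A B p q →
      All (λ am → P (proj₂ am)) p → All (λ am → Q (proj₂ am)) q →
      (∀ {m₁ m₂} → P m₁ → Q m₂ → m₁ ·ₘ m₂ ≡ A ·ₘ B → (m₁ ≡ A) × (m₂ ≡ B)) →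
      coeff (p *ₚ q) (A ·ₘ B) ≈ coeff p A * coeff q B
    coeff-*-unique P Q A B p q Pp Qq unique = begin
      coeff (p *ₚ q) (A ·ₘ B)                             ≈⟨ coeff≈ext-δ (p *ₚ q) (A ·ₘ B) ⟩
      ext (δ (A ·ₘ B)) (p *ₚ q)                           ≈⟨ ext-* (δ (A ·ₘ B)) p q ⟩
      ext (λ m₁ → ext (λ m₂ → δ (A ·ₘ B) (m₁ ·ₘ m₂)) q) p ≈⟨ ext-congᴬ p (All.map (λ {am} → outer {am}) Pp) ⟩
      ext (λ m₁ → δ A m₁ * ext (δ B) q) p                 ≈⟨ ext-scaleʳ (ext (δ B) q) (δ A) p ⟩
      ext (δ A) p * ext (δ B) q                           ≈⟨ *-cong (coeff≈ext-δ p A) (coeff≈ext-δ q B) ⟨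
      coeff p A * coeff q B                               ∎
      where
      δ-product : ∀ {m₁ m₂} → P m₁ → Q m₂ → Dec ((m₁ ·ₘ m₂) ≡ (A ·ₘ B)) → Dec (m₁ ≡ A) → Dec (m₂ ≡ B) →
                  δ (A ·ₘ B) (m₁ ·ₘ m₂) ≈ δ A m₁ * δ B m₂
      δ-product p₁ q₂ (yes e) _ _ with unique p₁ q₂ e
      ... | ≡.refl , ≡.refl = sym (trans (*-cong (δ-same A) (δ-same B)) (trans (*-identityˡ 1#) (sym (δ-same (A ·ₘ B)))))
      δ-product _ _ (no ne) (yes ≡.refl) (yes ≡.refl) = ⊥-elim (ne ≡.refl)
      δ-product _ _ (no ne) (no n₁) _       = trans (δ-diff ne) (sym (trans (*-congʳ (δ-diff n₁)) (zeroˡ _)))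
      δ-product _ _ (no ne) (yes _) (no n₂) = trans (δ-diff ne) (sym (trans (*-congˡ (δ-diff n₂)) (zeroʳ _)))
      outer : ∀ {am} → P (proj₂ am) → ext (λ m₂ → δ (A ·ₘ B) (proj₂ am ·ₘ m₂)) q ≈ δ A (proj₂ am) * ext (δ B) q
      outer {am} p₁ = trans (ext-congᴬ q (All.map (λ {bm} q₂ → δ-product p₁ q₂ ((proj₂ am ·ₘ proj₂ bm) ≟ₘ (A ·ₘ B)) (proj₂ am ≟ₘ A) (proj₂ bm ≟ₘ B)) Qq))
                            (ext-scaleˡ (δ A (proj₂ am)) (δ B) q)

  coeff-top : ∀ {a A b B p q} → Within a A p → Within b B q → coeff (p *ₚ q) (A ·ₘ B) ≈ coeff p A * coeff q B
  coeff-top {A = A} {B = B} {p} {q} (within bp) (within bq) =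
    coeff-*-unique (_≤ₘ A) (_≤ₘ B) A B p q (All.map proj₂ bp) (All.map proj₂ bq) ·ₘ-cancel

  coeff-bottom : ∀ {a A b B p q} → Within a A p → Within b B q → coeff (p *ₚ q) (a ·ₘ b) ≈ coeff p a * coeff q b
  coeff-bottom {a} {b = b} {p = p} {q} (within bp) (within bq) =
    coeff-*-unique (a ≤ₘ_) (b ≤ₘ_) a b p q (All.map proj₁ bp) (All.map proj₁ bq)
      (λ x y e → let r = ·ₘ-cancel x y (≡.sym e) in ≡.sym (proj₁ r) , ≡.sym (proj₂ r))

  Within-single : ∀ a m → Within m m ((a , m) ∷ [])
  Within-single a m = within ((≤ₘ-refl , ≤ₘ-refl) ∷ [])

  binomial : Fin n → Pol
  binomial i = var i -ₚ 1ₚ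

  quadratic : Fin n → Pol
  quadratic i = (var i *ₚ var i) -ₚ var i

  private
    Within-varProduct : ∀ l → Within (monOf l) (monOf l) (prodₚ (map var l))
    Within-varProduct []      = Within-single 1# oneₘ
    Within-varProduct (i ∷ l) = Within-* (Within-single 1# (varₘ i)) (Within-varProduct l)

    coeff-varProduct : ∀ l → coeff (prodₚ (map var l)) (monOf l) ≈ 1#
    coeff-varProduct []      = coeff-single 1# oneₘ
    coeff-varProduct (i ∷ l) = trans (coeff-top (Within-single 1# (varₘ i)) (Within-varProduct l))
      (trans (*-cong (coeff-single 1# (varₘ i)) (coeff-varProduct l)) (*-identityˡ 1#))

    Within-binomial : ∀ i → Within oneₘ (varₘ i) (binomial i)
    Within-binomial i = within ((one≤ₘ (varₘ i) , ≤ₘ-refl) ∷ (≤ₘ-refl , one≤ₘ (varₘ i)) ∷ [])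

    coeff-binomial-top : ∀ i → coeff (binomial i) (varₘ i) ≈ 1#
    coeff-binomial-top i = begin
      coeff (var i ++ -ₚ 1ₚ) (varₘ i)                 ≈⟨ coeff-++ (var i) (-ₚ 1ₚ) (varₘ i) ⟩
      coeff (var i) (varₘ i) + coeff (-ₚ 1ₚ) (varₘ i) ≈⟨ +-cong (coeff-single 1# (varₘ i)) (coeff-absent (-ₚ 1ₚ) (varₘ i) (oneₘ≢varₘ i ∷ [])) ⟩
      1# + 0#                                         ≈⟨ +-identityʳ 1# ⟩
      1#                                              ∎

    coeff-binomial-bottom : ∀ i → coeff (binomial i) oneₘ ≈ - 1#
    coeff-binomial-bottom i = begin
      coeff (var i ++ -ₚ 1ₚ) oneₘ             ≈⟨ coeff-++ (var i) (-ₚ 1ₚ) oneₘ ⟩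
      coeff (var i) oneₘ + coeff (-ₚ 1ₚ) oneₘ ≈⟨ +-cong (coeff-absent (var i) oneₘ ((λ e → oneₘ≢varₘ i (≡.sym e)) ∷ [])) (coeff-single (- 1#) oneₘ) ⟩
      0# + - 1#                               ≈⟨ +-identityˡ _ ⟩
      - 1#                                    ∎

    Within-binomialProduct : ∀ l → Within oneₘ (monOf l) (prodₚ (map binomial l))
    Within-binomialProduct []      = Within-single 1# oneₘ
    Within-binomialProduct (i ∷ l) = Within-subst (·ₘ-identityˡ oneₘ) ≡.refl (Within-* (Within-binomial i) (Within-binomialProduct l))

    coeff-binomialProduct-top : ∀ l → coeff (prodₚ (map binomial l)) (monOf l) ≈ 1#
    coeff-binomialProduct-top []      = coeff-single 1# oneₘ
    coeff-binomialProduct-top (i ∷ l) = trans (coeff-top (Within-binomial i) (Within-binomialProduct l))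
      (trans (*-cong (coeff-binomial-top i) (coeff-binomialProduct-top l)) (*-identityˡ 1#))

    coeff-binomialProduct-bottom : ∀ l → Sign (coeff (prodₚ (map binomial l)) oneₘ)
    coeff-binomialProduct-bottom []      = trans (*-cong (coeff-single 1# oneₘ) (coeff-single 1# oneₘ)) sign-1
    coeff-binomialProduct-bottom (i ∷ l) = trans (*-cong factor factor) (sign-* sign-−1 (coeff-binomialProduct-bottom l))
      where
      factor : coeff (prodₚ (map binomial (i ∷ l))) oneₘ ≈ - 1# * coeff (prodₚ (map binomial l)) oneₘ
      factor = ≡.subst (λ z → coeff (prodₚ (map binomial (i ∷ l))) z ≈ - 1# * coeff (prodₚ (map binomial l)) oneₘ)
                 (·ₘ-identityˡ oneₘ)
                 (trans (coeff-bottom (Within-binomial i) (Within-binomialProduct l)) (*-congʳ (coeff-binomial-bottom i)))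

    elements : Subset n → List (Fin n)
    elements B = filter (_∈? B) (allFin n)

  Within-xₛ : ∀ H → Within (𝐱 H) (𝐱 H) (xₛ H)
  Within-xₛ H = Within-subst (monOf-elements H) (monOf-elements H) (Within-varProduct (elements H))

  coeff-xₛ : ∀ H → coeff (xₛ H) (𝐱 H) ≈ 1#
  coeff-xₛ H = ≡.subst (λ z → coeff (xₛ H) z ≈ 1#) (monOf-elements H) (coeff-varProduct (elements H))

  Within-fSH : ∀ {S H} → H ⊑ S → Within (𝐱 H) (𝐱 S) (fSH S H)
  Within-fSH {S} {H} H⊑S =
    Within-subst (·ₘ-identityʳ (𝐱 H)) (≡.trans (≡.cong (𝐱 H ·ₘ_) (monOf-elements (S ─ H))) (𝐱-split H⊑S))
      (Within-* (Within-xₛ H) (Within-binomialProduct (elements (S ─ H))))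

  coeff-fSH-top : ∀ {S H} → H ⊑ S → coeff (fSH S H) (𝐱 S) ≈ 1#
  coeff-fSH-top {S} {H} H⊑S =
    ≡.subst (λ z → coeff (fSH S H) z ≈ 1#) (≡.trans (≡.cong (𝐱 H ·ₘ_) (monOf-elements (S ─ H))) (𝐱-split H⊑S))
      (trans (coeff-top (Within-xₛ H) (Within-binomialProduct (elements (S ─ H))))
        (trans (*-cong (coeff-xₛ H) (coeff-binomialProduct-top (elements (S ─ H)))) (*-identityˡ 1#)))

  coeff-fSH-bottom : ∀ S H → Sign (coeff (fSH S H) (𝐱 H))
  coeff-fSH-bottom S H = ≡.subst (λ z → Sign (coeff (fSH S H) z)) (·ₘ-identityʳ (𝐱 H))
    (trans (*-cong bottom bottom)
      (trans (*-cong (*-identityˡ _) (*-identityˡ _)) (coeff-binomialProduct-bottom (elements (S ─ H)))))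
    where
    bottom : coeff (fSH S H) (𝐱 H ·ₘ oneₘ) ≈ 1# * coeff (prodₚ (map binomial (elements (S ─ H)))) oneₘ
    bottom = trans (coeff-bottom (Within-xₛ H) (Within-binomialProduct (elements (S ─ H)))) (*-congʳ (coeff-xₛ H))

  Within-quadratic : ∀ i → Within oneₘ (square i) (quadratic i)
  Within-quadratic i =
    Within-++ (Within-weaken (one≤ₘ _) ≤ₘ-refl (Within-* (Within-single 1# (varₘ i)) (Within-single 1# (varₘ i))))
              (Within-neg (Within-weaken (one≤ₘ _) (≤ₘ-·ₘ (varₘ i) (varₘ i)) (Within-single 1# (varₘ i))))

  coeff-quadratic : ∀ i → coeff (quadratic i) (square i) ≈ 1#
  coeff-quadratic i = begin
    coeff ((var i *ₚ var i) ++ -ₚ var i) (square i)                 ≈⟨ coeff-++ (var i *ₚ var i) (-ₚ var i) (square i) ⟩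
    coeff (var i *ₚ var i) (square i) + coeff (-ₚ var i) (square i) ≈⟨ +-cong (coeff-top (Within-single 1# (varₘ i)) (Within-single 1# (varₘ i)))
                                                                               (coeff-absent (-ₚ var i) (square i) (varₘ≢square i ∷ [])) ⟩
    coeff (var i) (varₘ i) * coeff (var i) (varₘ i) + 0#            ≈⟨ +-identityʳ _ ⟩
    coeff (var i) (varₘ i) * coeff (var i) (varₘ i)                 ≈⟨ *-cong (coeff-single 1# (varₘ i)) (coeff-single 1# (varₘ i)) ⟩
    1# * 1#                                                         ≈⟨ *-identityˡ 1# ⟩
    1#                                                              ∎

  -- Evaluation at the 0/1 point X (the indicator vector of X): a monomial
  -- evaluates to 1 iff its support lies in X.
  indicator : Bool → Carrier
  indicator b = if b then 1# else 0#

  ev : Subset n → Pol → Carrier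
  ev X = ext (λ m → indicator (supp m ⊆ᵇ X))

  ev-++ : ∀ X p q → ev X (p ++ q) ≈ ev X p + ev X q
  ev-++ X = ext-++ _

  ev-neg : ∀ X p → ev X (-ₚ p) ≈ - ev X p
  ev-neg X = ext-neg _

  ev-* : ∀ X p q → ev X (p *ₚ q) ≈ ev X p * ev X q
  ev-* X p q = begin
    ev X (p *ₚ q)                                  ≈⟨ ext-* φ p q ⟩
    ext (λ m₁ → ext (λ m₂ → φ (m₁ ·ₘ m₂)) q) p     ≈⟨ ext-cong (λ m₁ → trans (ext-cong (φ-* m₁) q) (ext-scaleˡ (φ m₁) φ q)) p ⟩
    ext (λ m₁ → φ m₁ * ev X q) p                   ≈⟨ ext-scaleʳ (ev X q) φ p ⟩
    ev X p * ev X q                                ∎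
    where
    φ : Mon n → Carrier
    φ m = indicator (supp m ⊆ᵇ X)
    indicator-∧ : ∀ a b → indicator (a ∧ b) ≈ indicator a * indicator b
    indicator-∧ true  b = sym (*-identityˡ _)
    indicator-∧ false b = sym (zeroˡ _)
    φ-* : ∀ m₁ m₂ → φ (m₁ ·ₘ m₂) ≈ φ m₁ * φ m₂
    φ-* m₁ m₂ rewrite supp-·ₘ m₁ m₂ | ∪-⊆ᵇ (supp m₁) (supp m₂) X = indicator-∧ (supp m₁ ⊆ᵇ X) (supp m₂ ⊆ᵇ X)

  private
    empty⊆ᵇ : ∀ {k} (X : Subset k) → (replicate k false ⊆ᵇ X) ≡ true
    empty⊆ᵇ []      = ≡.refl
    empty⊆ᵇ (_ ∷ X) = empty⊆ᵇ X

    supp-oneₘ : ∀ {k} → supp (oneₘ {k}) ≡ replicate k false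
    supp-oneₘ {ℕ.zero} = ≡.refl
    supp-oneₘ {suc k}  = ≡.cong (false ∷_) supp-oneₘ

    supp-var⊆ᵇ : ∀ {k} (i : Fin k) (X : Subset k) → (supp (varₘ i) ⊆ᵇ X) ≡ bit i X
    supp-var⊆ᵇ {suc k} Fin.zero (x ∷ X) =
      ≡.trans (≡.cong (λ v → supp v ⊆ᵇ (x ∷ X)) (varₘ-zero {k})) (first x)
      where
      first : ∀ x → (supp (1 ∷ oneₘ {k}) ⊆ᵇ (x ∷ X)) ≡ bit Fin.zero (x ∷ X)
      first x rewrite supp-oneₘ {k} | empty⊆ᵇ X with x
      ... | true  = ≡.refl
      ... | false = ≡.refl
    supp-var⊆ᵇ {suc k} (Fin.suc i) (x ∷ X) =
      ≡.trans (≡.cong (λ v → supp v ⊆ᵇ (x ∷ X)) (varₘ-suc i)) (supp-var⊆ᵇ i X)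

  ev-var : ∀ X i → ev X (var i) ≈ indicator (bit i X)
  ev-var X i rewrite ≡.sym (supp-var⊆ᵇ i X) = trans (+-identityʳ _) (*-identityˡ _)

  ev-1 : ∀ X → ev X 1ₚ ≈ 1#
  ev-1 X rewrite supp-oneₘ {n} | empty⊆ᵇ X = trans (+-identityʳ _) (*-identityˡ _)

  private
    ev-product-zero : ∀ X (f : Fin n → Pol) l → Any (λ i → ev X (f i) ≈ 0#) l → ev X (prodₚ (map f l)) ≈ 0#
    ev-product-zero X f (i ∷ l) (here e)  = trans (ev-* X (f i) _) (trans (*-congʳ e) (zeroˡ _))
    ev-product-zero X f (i ∷ l) (there a) = trans (ev-* X (f i) _) (trans (*-congˡ (ev-product-zero X f l a)) (zeroʳ _))

  ev-fSH-missing : ∀ X S H → Any (λ i → bit i X ≡ false) (filter (_∈? H) (allFin n)) → ev X (fSH S H) ≈ 0#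
  ev-fSH-missing X S H missing =
    trans (ev-* X (xₛ H) _) (trans (*-congʳ (ev-product-zero X var _ (Any.map vanish missing))) (zeroˡ _))
    where
    vanish : ∀ {i} → bit i X ≡ false → ev X (var i) ≈ 0#
    vanish {i} e = trans (ev-var X i) (≡.subst (λ b → indicator b ≈ 0#) (≡.sym e) refl)

  ev-fSH-present : ∀ X S H → Any (λ i → bit i X ≡ true) (filter (_∈? (S ─ H)) (allFin n)) → ev X (fSH S H) ≈ 0#
  ev-fSH-present X S H present =
    trans (ev-* X (xₛ H) _) (trans (*-congˡ (ev-product-zero X binomial _ (Any.map vanish present))) (zeroʳ _))
    where
    vanish : ∀ {i} → bit i X ≡ true → ev X (binomial i) ≈ 0#
    vanish {i} e = begin
      ev X (var i ++ -ₚ 1ₚ)           ≈⟨ ev-++ X (var i) (-ₚ 1ₚ) ⟩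
      ev X (var i) + ev X (-ₚ 1ₚ)     ≈⟨ +-cong (trans (ev-var X i) (≡.subst (λ b → indicator b ≈ 1#) (≡.sym e) refl))
                                                (trans (ev-neg X 1ₚ) (-‿cong (ev-1 X))) ⟩
      1# + - 1#                       ≈⟨ -‿inverseʳ 1# ⟩
      0#                              ∎

  ev-quadratic : ∀ X i → ev X (quadratic i) ≈ 0#
  ev-quadratic X i = begin
    ev X ((var i *ₚ var i) ++ -ₚ var i)       ≈⟨ ev-++ X (var i *ₚ var i) (-ₚ var i) ⟩
    ev X (var i *ₚ var i) + ev X (-ₚ var i)   ≈⟨ +-cong (trans (ev-* X (var i) (var i)) (*-cong (ev-var X i) (ev-var X i)))
                                                        (trans (ev-neg X (var i)) (-‿cong (ev-var X i))) ⟩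
    b * b + - b                               ≈⟨ +-congʳ (idempotent (bit i X)) ⟩
    b + - b                                   ≈⟨ -‿inverseʳ _ ⟩
    0#                                        ∎
    where
    b = indicator (bit i X)
    idempotent : ∀ b → indicator b * indicator b ≈ indicator b
    idempotent true  = *-identityˡ 1#
    idempotent false = zeroˡ 0#

  ev-combination : ∀ X (qgs : List (Pol × Pol)) → All (λ qg → ev X (proj₂ qg) ≈ 0#) qgs →
                   ev X (sumₚ (map (λ qg → proj₁ qg *ₚ proj₂ qg) qgs)) ≈ 0#
  ev-combination X []              []       = refl
  ev-combination X ((q , g) ∷ qgs) (e ∷ es) = trans (ev-++ X (q *ₚ g) _)
    (trans (+-cong (trans (ev-* X q g) (trans (*-congˡ e) (zeroʳ _))) (ev-combination X qgs es)) (+-identityˡ 0#))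

  module LeadingMonomials (O : TermOrder n) where
    open TermOrder O

    ∣ₘ⇒≼ : ∀ {m M} → m ∣ₘ M → m ≼ M
    ∣ₘ⇒≼ {m} (u , ≡.refl) = ≡.subst₂ _≼_ (·ₘ-identityʳ m) (·ₘ-comm m u) (compat m (one-min u))

    IsLM-top : ∀ {lo M g} → Within lo M g → ¬ (coeff g M ≈ 0#) → IsLM O g M
    IsLM-top {M = M} {g} bounds nonzero = nonzero , λ m′ M≺m′ → above m′ M≺m′ (≤ₘ-dec m′ M)
      where
      above : ∀ m′ → M ≺ m′ → Dec (m′ ≤ₘ M) → coeff g m′ ≈ 0#
      above m′ (M≼m′ , M≢m′) (yes m′≤M) = ⊥-elim (M≢m′ (antisym≼ M≼m′ (∣ₘ⇒≼ (≤ₘ⇒∣ₘ m′≤M))))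
      above m′ _            (no m′≰M) = coeff-above bounds m′≰M

    IsLM-unique : ∀ {g m₁ m₂} → IsLM O g m₁ → IsLM O g m₂ → m₁ ≡ m₂
    IsLM-unique {m₁ = m₁} {m₂} (nz₁ , top₁) (nz₂ , top₂) with m₁ ≟ₘ m₂
    ... | yes e = e
    ... | no ne with total≼ m₁ m₂
    ...   | inj₁ le = ⊥-elim (nz₂ (top₁ m₂ (le , ne)))
    ...   | inj₂ le = ⊥-elim (nz₁ (top₂ m₁ (le , λ e → ne (≡.sym e))))

module LinearAlgebra {c ℓ} (F : Field c ℓ) where

  open FieldFacts F
  open import Level using (_⊔_)
  open import Data.Nat using (zero; suc; _<_; s≤s)
  import Data.Nat.Properties as NP
  open import Data.Fin as Fin using (Fin; punchIn; punchOut)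
  import Data.Fin.Properties as FinP
  open import Data.Product using (Σ; ∃; _×_; _,_)
  open import Data.Empty using (⊥-elim)
  open import Relation.Nullary using (¬_; Dec; yes; no; ¬?)
  open import Relation.Nullary.Decidable using (¬¬-excluded-middle)
  open import Relation.Nullary.Negation using (¬¬-map)
  open import Relation.Binary.PropositionalEquality as ≡ using (_≡_; _≢_)
  open import Function using (_∘_)

  open Field F
  open import Relation.Binary.Reasoning.Setoid setoid
  open import Algebra.Properties.Semiring.Sum semiring public
    using (sum; sum-remove; ∑-distrib-+; *-distribˡ-sum; *-distribʳ-sum; sum-cong-≋; sum-replicate-zero)

  ¬¬-bind : ∀ {a b} {A : Set a} {B : Set b} → ¬ ¬ A → (A → ¬ ¬ B) → ¬ ¬ B
  ¬¬-bind ¬¬a f ¬b = ¬¬a (λ a → f a ¬b)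

  ¬¬-decide : ∀ {a} k (P : Fin k → Set a) → ¬ ¬ (∀ i → Dec (P i))
  ¬¬-decide zero    P = λ ¬t → ¬t (λ ())
  ¬¬-decide (suc k) P = ¬¬-bind ¬¬-excluded-middle λ d₀ →
    ¬¬-map (λ t → λ { Fin.zero → d₀ ; (Fin.suc i) → t i }) (¬¬-decide k (P ∘ Fin.suc))

  sum-zero : ∀ {k} {f : Fin k → Carrier} → (∀ i → f i ≈ 0#) → sum f ≈ 0#
  sum-zero {k} f≈0 = trans (sum-cong-≋ f≈0) (sum-replicate-zero k)

  sum-single : ∀ {k} (f : Fin k → Carrier) i → (∀ j → j ≢ i → f j ≈ 0#) → sum f ≈ f i
  sum-single {suc _} f i others≈0 = trans (sum-remove {i = i} f)
    (trans (+-congˡ (sum-zero (λ j → others≈0 (punchIn i j) (FinP.punchInᵢ≢i i j)))) (+-identityʳ _))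

  Dependent : ∀ k m → (Fin k → Fin m → Carrier) → Set (c ⊔ ℓ)
  Dependent k m w = Σ (Fin k → Carrier) λ coef →
    (∃ λ j → ¬ (coef j ≈ 0#)) × (∀ i → sum (λ j → coef j * w j i) ≈ 0#)

  -- Gaussian elimination step: clear column 0 using the pivot row p,
  -- where b is the inverse of the pivot entry.
  module Elimination {k m} (w : Fin (suc k) → Fin (suc m) → Carrier) (p : Fin (suc k))
                     (b : Carrier) (pivot-inverse : w p Fin.zero * b ≈ 1#) where

    cleared : Fin k → Fin (suc m) → Carrier
    cleared j i = w (punchIn p j) i + - ((w (punchIn p j) Fin.zero * b) * w p i)

    cleared-zero : ∀ j → cleared j Fin.zero ≈ 0#
    cleared-zero j = begin
      w′ + - ((w′ * b) * w p Fin.zero)  ≈⟨ +-congˡ (-‿cong (*-assoc _ _ _)) ⟩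
      w′ + - (w′ * (b * w p Fin.zero))  ≈⟨ +-congˡ (-‿cong (*-congˡ (trans (*-comm _ _) pivot-inverse))) ⟩
      w′ + - (w′ * 1#)                  ≈⟨ +-congˡ (-‿cong (*-identityʳ _)) ⟩
      w′ + - w′                         ≈⟨ -‿inverseʳ _ ⟩
      0#                                ∎
      where w′ = w (punchIn p j) Fin.zero

    lift : (Fin k → Carrier) → Fin (suc k) → Carrier
    lift coef x with p Fin.≟ x
    ... | yes _   = - sum (λ j → coef j * (w (punchIn p j) Fin.zero * b))
    ... | no p≢x  = coef (punchOut p≢x)

    lift-punchIn : ∀ coef j → lift coef (punchIn p j) ≈ coef j
    lift-punchIn coef j with p Fin.≟ punchIn p j
    ... | yes e  = ⊥-elim (FinP.punchInᵢ≢i p j (≡.sym e))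
    ... | no _   = reflexive (≡.cong coef (≡.trans (FinP.punchOut-cong p ≡.refl) (FinP.punchOut-punchIn p)))

    lift-combination : ∀ coef i → sum (λ x → lift coef x * w x i) ≈ sum (λ j → coef j * cleared j i)
    lift-combination coef i = begin
      sum (λ x → lift coef x * w x i)                 ≈⟨ sum-remove {i = p} (λ x → lift coef x * w x i) ⟩
      lift coef p * w p i + sum (λ j → lift coef (punchIn p j) * w (punchIn p j) i)
                                                      ≈⟨ +-cong (*-congʳ lift-p) (sum-cong-≋ (λ j → *-congʳ (lift-punchIn coef j))) ⟩
      - S * w p i + Σrest                             ≈⟨ +-congʳ (-‿distribˡ-* S (w p i)) ⟨
      - (S * w p i) + Σrest                           ≈⟨ +-comm _ _ ⟩
      Σrest + - (S * w p i)                           ≈⟨ +-congˡ (-‿cong (*-distribʳ-sum (w p i) (λ j → coef j * s j))) ⟩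
      Σrest + - sum (λ j → (coef j * s j) * w p i)    ≈⟨ +-congˡ (negate-sum (λ j → (coef j * s j) * w p i)) ⟨
      Σrest + sum (λ j → - ((coef j * s j) * w p i))  ≈⟨ ∑-distrib-+ (λ j → coef j * w (punchIn p j) i) (λ j → - ((coef j * s j) * w p i)) ⟨
      sum (λ j → coef j * w (punchIn p j) i + - ((coef j * s j) * w p i))
                                                      ≈⟨ sum-cong-≋ (λ j → termwise j) ⟩
      sum (λ j → coef j * cleared j i)                ∎
      where
      s : Fin k → Carrier
      s j = w (punchIn p j) Fin.zero * b
      S = sum (λ j → coef j * s j)
      Σrest = sum (λ j → coef j * w (punchIn p j) i)
      lift-p : lift coef p ≈ - S
      lift-p with p Fin.≟ p
      ... | yes _  = refl
      ... | no p≢p = ⊥-elim (p≢p ≡.refl)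
      negate-sum : ∀ {l} (f : Fin l → Carrier) → sum (λ j → - f j) ≈ - sum f
      negate-sum {zero}  f = sym -0#≈0#
      negate-sum {suc l} f = trans (+-congˡ (negate-sum (f ∘ Fin.suc))) (-‿+-comm _ _)
      termwise : ∀ j → coef j * w (punchIn p j) i + - ((coef j * s j) * w p i) ≈ coef j * cleared j i
      termwise j = begin
        coef j * w (punchIn p j) i + - ((coef j * s j) * w p i)  ≈⟨ +-congˡ (-‿cong (*-assoc _ _ _)) ⟩
        coef j * w (punchIn p j) i + - (coef j * (s j * w p i))  ≈⟨ +-congˡ (-‿distribʳ-* _ _) ⟩
        coef j * w (punchIn p j) i + coef j * - (s j * w p i)    ≈⟨ distribˡ _ _ _ ⟨
        coef j * cleared j i                                     ∎

  dependent : ∀ m k → m < k → (w : Fin k → Fin m → Carrier) → ¬ ¬ Dependent k m w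
  dependent zero (suc k) _ w = λ ¬dep → ¬dep ((λ _ → 1#) , (Fin.zero , λ 1≈0 → 0≉1 (sym 1≈0)) , λ ())
  dependent (suc m) (suc k) (s≤s m<k) w =
    ¬¬-bind (¬¬-decide (suc k) (λ j → w j Fin.zero ≈ 0#)) λ column₀? →
      case (FinP.any? (λ j → ¬? (column₀? j))) column₀?
    where
    case : Dec (∃ λ j → ¬ (w j Fin.zero ≈ 0#)) → (∀ j → Dec (w j Fin.zero ≈ 0#)) → ¬ ¬ Dependent (suc k) (suc m) w
    -- column 0 vanishes: use a dependence among the remaining columns
    case (no no-pivot) column₀? = ¬¬-map extend (dependent m (suc k) (NP.m≤n⇒m≤1+n m<k) (λ j i → w j (Fin.suc i)))
      where
      column₀-zero : ∀ j → w j Fin.zero ≈ 0#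
      column₀-zero j with column₀? j
      ... | yes z  = z
      ... | no nz  = ⊥-elim (no-pivot (j , nz))
      extend : Dependent (suc k) m (λ j i → w j (Fin.suc i)) → Dependent (suc k) (suc m) w
      extend (coef , nontrivial , vanishes) = coef , nontrivial , λ
        { Fin.zero    → sum-zero (λ j → trans (*-congˡ (column₀-zero j)) (zeroʳ (coef j)))
        ; (Fin.suc i) → vanishes i }
    -- a pivot p: eliminate it and lift a dependence among the cleared rows
    case (yes (p , pivot≉0)) _ with inverse (w p Fin.zero) pivot≉0
    ... | b , pivot-inverse = ¬¬-map lift-dependence (dependent m k m<k (λ j i → cleared j (Fin.suc i)))
      where
      open Elimination w p b pivot-inverse
      lift-dependence : Dependent k m (λ j i → cleared j (Fin.suc i)) → Dependent (suc k) (suc m) w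
      lift-dependence (coef , (j₀ , coef≉0) , vanishes) =
        lift coef , (punchIn p j₀ , λ ≈0 → coef≉0 (trans (sym (lift-punchIn coef j₀)) ≈0)) , λ i →
          trans (lift-combination coef i) (column i)
        where
        column : ∀ i → sum (λ j → coef j * cleared j i) ≈ 0#
        column Fin.zero    = sum-zero (λ j → trans (*-congˡ (cleared-zero j)) (zeroʳ (coef j)))
        column (Fin.suc i) = vanishes i

module Extremal {a r} {A : Set a} (R : A → A → Set r) (R-total : ∀ x y → R x y ⊎ R y x)
                (R-trans : ∀ {x y z} → R x y → R y z → R x z) where

  open import Data.Nat using (zero; suc)
  open import Data.Fin as Fin using (Fin)
  open import Data.Product using (Σ; _×_; _,_)
  open import Data.Sum using (_⊎_; inj₁; inj₂)
  open import Data.Empty using (⊥-elim)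
  open import Relation.Nullary using (¬_; Dec; yes; no)
  open import Function using (_∘_)

  private
    R-refl : ∀ x → R x x
    R-refl x with R-total x x
    ... | inj₁ r = r
    ... | inj₂ r = r

    best : ∀ {q} k (key : Fin k → A) (Q : Fin k → Set q) → (∀ i → Dec (Q i)) →
           (∀ i → ¬ Q i) ⊎ Σ (Fin k) λ i → Q i × (∀ j → Q j → R (key i) (key j))
    best zero    key Q Q? = inj₁ (λ ())
    best (suc k) key Q Q? with Q? Fin.zero | best k (key ∘ Fin.suc) (Q ∘ Fin.suc) (Q? ∘ Fin.suc)
    ... | no ¬q₀ | inj₁ none = inj₁ λ { Fin.zero → ¬q₀ ; (Fin.suc i) → none i }
    ... | no ¬q₀ | inj₂ (i , qᵢ , minᵢ) =
      inj₂ (Fin.suc i , qᵢ , λ { Fin.zero q → ⊥-elim (¬q₀ q) ; (Fin.suc j) q → minᵢ j q })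
    ... | yes q₀ | inj₁ none = inj₂ (Fin.zero , q₀ , λ { Fin.zero _ → R-refl _ ; (Fin.suc j) q → ⊥-elim (none j q) })
    ... | yes q₀ | inj₂ (i , qᵢ , minᵢ) with R-total (key Fin.zero) (key (Fin.suc i))
    ...   | inj₁ r = inj₂ (Fin.zero , q₀ , λ { Fin.zero _ → R-refl _ ; (Fin.suc j) q → R-trans r (minᵢ j q) })
    ...   | inj₂ r = inj₂ (Fin.suc i , qᵢ , λ { Fin.zero _ → r ; (Fin.suc j) q → minᵢ j q })

  argmin : ∀ {q} k (key : Fin k → A) (Q : Fin k → Set q) → (∀ i → Dec (Q i)) → Σ (Fin k) Q →
           Σ (Fin k) λ i → Q i × (∀ j → Q j → R (key i) (key j))
  argmin k key Q Q? (i₀ , q₀) with best k key Q Q?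
  ... | inj₁ none = ⊥-elim (none i₀ q₀)
  ... | inj₂ r    = r

module Main {c ℓ} (F : Field c ℓ) (n : ℕ) (𝒮 : List (Subset n)) (h : Subset n → Subset n)
            (h⊆ : ∀ {S} → S ∈ 𝒮 → h S ⊆ S) where

  open import Data.Nat as ℕ using (zero; suc; _∸_; _≤_; _<_; s≤s)
  import Data.Nat.Properties as NP
  open import Data.Bool using (Bool; true; false)
  import Data.Bool.Properties as BoolP
  open import Data.Fin as Fin using (Fin)
  open import Data.Fin.Subset using (_─_; ∁) renaming (⊤ to ⊤ₛ)
  open import Data.Fin.Subset.Properties using (_∈?_)
  open import Data.List as List using ([]; _∷_; map; filter; allFin; concatMap; lookup)
  open import Data.List.Membership.Propositional using (find; lose)
  open import Data.List.Membership.Propositional.Properties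
  import Data.List.Relation.Unary.Any as Any
  import Data.List.Relation.Unary.Any.Properties as AnyP
  import Data.List.Relation.Unary.All as All
  import Data.List.Relation.Unary.All.Properties as AllP
  open import Data.List.Relation.Unary.Unique.Propositional using (Unique)
  import Data.List.Relation.Unary.Unique.Propositional.Properties as UniqueP
  import Data.List.Membership.DecPropositional as DecMembership
  open import Data.Product using (Σ; _×_; _,_; proj₁; proj₂)
  open import Data.Sum using (inj₁; inj₂; swap)
  open import Data.Empty using (⊥; ⊥-elim)
  open import Data.Unit using (tt) renaming (⊤ to Unit)
  open import Function.Bundles using (mk⇔)
  open import Relation.Nullary using (¬_; Dec; yes; no; ¬?; does)
  open import Relation.Nullary.Decidable using (¬¬-excluded-middle)
  open import Relation.Binary.PropositionalEquality as ≡ using (_≢_)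
  open import Function using (_∘_)

  open Subsets
  open Monomials
  open SetFamilies
  open FieldFacts F
  open LinearAlgebra F
  open Field F
  open Poly F n
  open Polynomials F n
  open import Relation.Binary.Reasoning.Setoid setoid
  open DecMembership (_≟ₛ_ {n}) using () renaming (_∈?_ to _∈ᴸ?_)

  h⊑ : ∀ {S} → S ∈ 𝒮 → h S ⊑ S
  h⊑ S∈ = ⊆⇒⊑ (h⊆ S∈)

  𝒫∪ : List (Subset n)
  𝒫∪ = concatMap 𝒫 𝒮

  𝒬∪ : List (Subset n)
  𝒬∪ = concatMap (λ S → 𝒬 S (h S)) 𝒮

  𝒫∪-elim : ∀ {T} → T ∈ 𝒫∪ → Σ (Subset n) λ S → (S ∈ 𝒮) × S ⊑ T
  𝒫∪-elim T∈ with find (∈-concatMap⁻ 𝒫 {xs = 𝒮} T∈)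
  ... | S , S∈ , T∈𝒫S = S , S∈ , 𝒫-elim T∈𝒫S

  𝒫∪-intro : ∀ {S T} → S ∈ 𝒮 → S ⊑ T → T ∈ 𝒫∪
  𝒫∪-intro S∈ S⊑T = ∈-concatMap⁺ 𝒫 {xs = 𝒮} (lose S∈ (𝒫-intro S⊑T))

  𝒬∪-elim : ∀ {Y} → Y ∈ 𝒬∪ → Σ (Subset n) λ S → (S ∈ 𝒮) × Y ∈ 𝒬 S (h S)
  𝒬∪-elim Y∈ = find (∈-concatMap⁻ (λ S → 𝒬 S (h S)) {xs = 𝒮} Y∈)

  𝒬∪-intro : ∀ {S Y} → S ∈ 𝒮 → Y ∈ 𝒬 S (h S) → Y ∈ 𝒬∪
  𝒬∪-intro S∈ Y∈ = ∈-concatMap⁺ (λ S → 𝒬 S (h S)) {xs = 𝒮} (lose S∈ Y∈)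

  ℋ𝒮 : List (Subset n)
  ℋ𝒮 = ℋ 𝒮

  ℱ𝒮 : List (Subset n)
  ℱ𝒮 = ℱ 𝒮 h

  ℋ-intro : ∀ {T} → ¬ (T ∈ 𝒫∪) → T ∈ ℋ𝒮
  ℋ-intro {T} T∉ = ∈-filter⁺ (λ T → ¬? (T ∈ᴸ? 𝒫∪)) (allSubsets-complete T) T∉

  ℱ-elim : ∀ {T} → T ∈ ℱ𝒮 → ¬ (T ∈ 𝒬∪)
  ℱ-elim T∈ = proj₂ (∈-filter⁻ (λ T → ¬? (T ∈ᴸ? 𝒬∪)) {xs = allSubsets n} T∈)

  #ℋ #ℱ : ℕ
  #ℋ = List.length ℋ𝒮
  #ℱ = List.length ℱ𝒮

  ℋ[_] : Fin #ℋ → Subset n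
  ℋ[_] = lookup ℋ𝒮

  ℱ[_] : Fin #ℱ → Subset n
  ℱ[_] = lookup ℱ𝒮

  ℱ-injective : ∀ x y → ℱ[ x ] ≡ ℱ[ y ] → x ≡ y
  ℱ-injective = lookup-injective (UniqueP.filter⁺ _ (allSubsets-unique n))

  index : ∀ {T} {L : List (Subset n)} → T ∈ L → Σ (Fin (List.length L)) λ j → lookup L j ≡ T
  index T∈ = Any.index T∈ , ≡.sym (AnyP.lookup-index T∈)

  f : Subset n → Pol
  f S = fSH S (h S)

  𝔾𝒮 : List Pol
  𝔾𝒮 = 𝔾 𝒮 h

  f∈𝔾 : ∀ {S} → S ∈ 𝒮 → f S ∈ 𝔾𝒮
  f∈𝔾 S∈ = ∈-++⁺ˡ (∈-map⁺ f S∈)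

  quadratic∈𝔾 : ∀ i → quadratic i ∈ 𝔾𝒮
  quadratic∈𝔾 i = ∈-++⁺ʳ (map f 𝒮) (∈-map⁺ quadratic (∈-allFin i))

  𝔾-cases : ∀ {g} → g ∈ 𝔾𝒮 → (Σ (Subset n) λ S → (S ∈ 𝒮) × (g ≡ f S)) ⊎ (Σ (Fin n) λ i → g ≡ quadratic i)
  𝔾-cases g∈ with ∈-++⁻ (map f 𝒮) g∈
  ... | inj₁ g∈f with ∈-map⁻ f g∈f
  ...   | S , S∈ , e = inj₁ (S , S∈ , e)
  𝔾-cases g∈ | inj₂ g∈q with ∈-map⁻ quadratic g∈q
  ...   | i , _ , e = inj₂ (i , e)

  -- Every generator vanishes at every point of ℱ: X ∉ 𝒬_{S,h(S)} means X
  -- misses some i ∈ h(S) or contains some i ∈ S ∖ h(S).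
  ev-f-ℱ : ∀ {X S} → X ∈ ℱ𝒮 → S ∈ 𝒮 → ev X (f S) ≈ 0#
  ev-f-ℱ {X} {S} X∈ S∈ with Any.any? (λ i → bit i X BoolP.≟ false) (filter (_∈? h S) (allFin n))
  ... | yes missing = ev-fSH-missing X S (h S) missing
  ... | no ¬missing with Any.any? (λ i → bit i X BoolP.≟ true) (filter (_∈? (S ─ h S)) (allFin n))
  ...   | yes present = ev-fSH-present X S (h S) present
  ...   | no ¬present = ⊥-elim (ℱ-elim X∈ (𝒬∪-intro S∈ (𝒬-intro (h⊑ S∈) contains avoids)))
    where
    member : ∀ {A : Subset n} i → does (i ∈? A) ≡ true → i ∈ filter (_∈? A) (allFin n)
    member {A} i e with i ∈? A
    ... | yes i∈A = ∈-filter⁺ (_∈? A) (∈-allFin i) i∈A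
    contains : ∀ i → bit i (h S) ≡ true → bit i X ≡ true
    contains i e with bit i X in eq
    ... | true  = ≡.refl
    ... | false = ⊥-elim (¬missing (lose (member i e) eq))
    avoids : ∀ i → bit i (S ─ h S) ≡ true → bit i X ≡ false
    avoids i e with bit i X in eq
    ... | false = ≡.refl
    ... | true  = ⊥-elim (¬present (lose (member i e) eq))

  ev-𝔾-ℱ : ∀ {X g} → X ∈ ℱ𝒮 → g ∈ 𝔾𝒮 → ev X g ≈ 0#
  ev-𝔾-ℱ {X} X∈ g∈ with 𝔾-cases g∈
  ... | inj₁ (S , S∈ , ≡.refl) = ev-f-ℱ X∈ S∈
  ... | inj₂ (i , ≡.refl)      = ev-quadratic X i

  ev-ideal-ℱ : ∀ {X p} → X ∈ ℱ𝒮 → p ∈⟨ 𝔾𝒮 ⟩ → ev X p ≈ 0#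
  ev-ideal-ℱ {X} {p} X∈ (qgs , gs∈ , p≈) =
    trans (ext-resp-≈ₚ _ {p} {sumₚ (map (λ qg → proj₁ qg *ₚ proj₂ qg) qgs)} p≈)
          (ev-combination X qgs (All.map (ev-𝔾-ℱ X∈) gs∈))

  ψ : (Fin #ℱ → Carrier) → Subset n → Carrier
  ψ d W = sum (λ x → d x * indicator (W ⊆ᵇ ℱ[ x ]))

  Λ : (Fin #ℱ → Carrier) → Pol → Carrier
  Λ d = ext (λ m → ψ d (supp m))

  ext-combination : ∀ {k} (d : Fin k → Carrier) (φ : Fin k → Mon n → Carrier) p →
    ext (λ m → sum (λ x → d x * φ x m)) p ≈ sum (λ x → d x * ext (φ x) p)
  ext-combination d φ []            = sym (sum-zero (λ x → zeroʳ (d x)))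
  ext-combination d φ ((a , m) ∷ p) = begin
    a * sum (λ x → d x * φ x m) + ext _ p                          ≈⟨ +-cong (*-distribˡ-sum a (λ x → d x * φ x m)) (ext-combination d φ p) ⟩
    sum (λ x → a * (d x * φ x m)) + sum (λ x → d x * ext (φ x) p)  ≈⟨ ∑-distrib-+ (λ x → a * (d x * φ x m)) (λ x → d x * ext (φ x) p) ⟨
    sum (λ x → a * (d x * φ x m) + d x * ext (φ x) p)              ≈⟨ sum-cong-≋ (λ x → trans (+-congʳ (*-exchange a (d x) (φ x m))) (sym (distribˡ (d x) _ _))) ⟩
    sum (λ x → d x * (a * φ x m + ext (φ x) p))                    ∎

  Λ≈Σev : ∀ d p → Λ d p ≈ sum (λ x → d x * ev ℱ[ x ] p)
  Λ≈Σev d p = ext-combination d (λ x m → indicator (supp m ⊆ᵇ ℱ[ x ])) p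

  Λ-ideal : ∀ d {p} → p ∈⟨ 𝔾𝒮 ⟩ → Λ d p ≈ 0#
  Λ-ideal d {p} p∈I = trans (Λ≈Σev d p) (sum-zero (λ x → trans (*-congˡ (ev-ideal-ℱ {p = p} (∈-lookup x) p∈I)) (zeroʳ _)))

  Λ-multiple : ∀ d {S} B → S ∈ 𝒮 → Λ d (xₛ B *ₚ f S) ≈ 0#
  Λ-multiple d {S} B S∈ = trans (Λ≈Σev d (xₛ B *ₚ f S)) (sum-zero λ x →
    trans (*-congˡ (trans (ev-* ℱ[ x ] (xₛ B) (f S)) (trans (*-congˡ (ev-f-ℱ (∈-lookup x) S∈)) (zeroʳ _)))) (zeroʳ _))

  -- If φ vanishes on ℋ ∩ Z, it vanishes
  -- on Z: a W ∈ Z outside ℋ contains some S ∈ 𝒮, and 𝐱(W∖S)·f_S has top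
  -- monomial 𝐱 W with coefficient 1 and otherwise only monomials below 𝐱 W,
  -- whose supports are proper subsets of W (handled by induction on |W|).
  reduction : (φ : Subset n → Carrier) (Z : Subset n → Set) →
    (∀ {V W} → V ⊑ W → Z W → Z V) →
    (∀ {S} B → S ∈ 𝒮 → ext (λ m → φ (supp m)) (xₛ B *ₚ f S) ≈ 0#) →
    (∀ U → U ∈ ℋ𝒮 → Z U → φ U ≈ 0#) →
    ∀ W → Z W → φ W ≈ 0#
  reduction φ Z down-closed kills-multiples vanishes-on-ℋ W₀ = go (suc (size W₀)) W₀ NP.≤-refl
    where
    go : ∀ k W → size W < k → Z W → φ W ≈ 0#
    go (suc k) W (s≤s |W|≤k) W∈Z with W ∈ᴸ? 𝒫∪
    ... | no W∉ = vanishes-on-ℋ W (ℋ-intro W∉) W∈Z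
    ... | yes W∈ with 𝒫∪-elim W∈
    ...   | S , S∈ , S⊑W = begin
      φ W                                       ≈⟨ *-identityˡ _ ⟨
      1# * φ W                                  ≈⟨ *-cong (sym top-coeff) (reflexive (≡.cong φ (≡.sym (supp-𝐱 W)))) ⟩
      coeff g (𝐱 W) * φ (supp (𝐱 W))            ≈⟨ isolation (λ m → φ (supp m)) (𝐱 W) g lower-terms ⟨
      ext (λ m → φ (supp m)) g                  ≈⟨ kills-multiples (W ─ S) S∈ ⟩
      0#                                        ∎
      where
      g = xₛ (W ─ S) *ₚ f S
      bounds : Within (𝐱 (W ─ S) ·ₘ 𝐱 (h S)) (𝐱 W) g
      bounds = Within-subst ≡.refl (𝐱-split′ S⊑W) (Within-* (Within-xₛ (W ─ S)) (Within-fSH (h⊑ S∈)))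
      top-coeff : coeff g (𝐱 W) ≈ 1#
      top-coeff = ≡.subst (λ z → coeff g z ≈ 1#) (𝐱-split′ S⊑W)
        (trans (coeff-top (Within-xₛ (W ─ S)) (Within-fSH (h⊑ S∈)))
               (trans (*-cong (coeff-xₛ (W ─ S)) (coeff-fSH-top (h⊑ S∈))) (*-identityˡ 1#)))
      lower-terms : ∀ m → m ≢ 𝐱 W → coeff g m * φ (supp m) ≈ 0#
      lower-terms m m≢ with ≤ₘ-dec m (𝐱 W)
      ... | no m≰  = trans (*-congʳ (coeff-above bounds m≰)) (zeroˡ _)
      ... | yes m≤ = trans (*-congˡ (go k (supp m) smaller (down-closed supp⊑ W∈Z))) (zeroʳ _)
        where
        supp⊑ = ≤𝐱⇒⊑ m≤
        smaller : size (supp m) < k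
        smaller = NP.<-≤-trans (⊏⇒size< supp⊑ (λ e → m≢ (≤𝐱∧supp≡⇒≡ m≤ e))) |W|≤k

  -- Möbius inversion on ℱ: if ψ_d vanishes on every set then d = 0
  -- (at ℱ[x], only d_x and the d_y with ℱ[x] ⊊ ℱ[y] contribute).
  möbius : (d : Fin #ℱ → Carrier) → (∀ W → ψ d W ≈ 0#) → ∀ x → d x ≈ 0#
  möbius d ψ≈0 x₀ = go (suc (n ∸ size ℱ[ x₀ ])) x₀ NP.≤-refl
    where
    go : ∀ r x → n ∸ size ℱ[ x ] < r → d x ≈ 0#
    go (suc r) x (s≤s bound) = begin
      d x                                     ≈⟨ *-identityʳ (d x) ⟨
      d x * 1#                                ≈⟨ *-congˡ (reflexive (≡.cong indicator (holds (⊑-refl ℱ[ x ])))) ⟨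
      d x * indicator (ℱ[ x ] ⊆ᵇ ℱ[ x ])      ≈⟨ sum-single term x others ⟨
      ψ d ℱ[ x ]                              ≈⟨ ψ≈0 ℱ[ x ] ⟩
      0#                                      ∎
      where
      term : Fin #ℱ → Carrier
      term y = d y * indicator (ℱ[ x ] ⊆ᵇ ℱ[ y ])
      others : ∀ y → y ≢ x → term y ≈ 0#
      others y y≢x with ℱ[ x ] ⊆ᵇ ℱ[ y ] in eq
      ... | false = zeroʳ (d y)
      ... | true  = trans (*-identityʳ (d y)) (go r y larger)
        where
        larger : n ∸ size ℱ[ y ] < r
        larger = NP.<-≤-trans (NP.∸-monoʳ-< (⊏⇒size< (sub eq) (λ e → y≢x (≡.sym (ℱ-injective x y e)))) (size≤n ℱ[ y ])) bound

  -- |ℱ| ≤ |ℋ|: a d with ψ_d = 0 on ℋ has ψ_d = 0 everywhere (reduction),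
  -- hence d = 0 (Möbius inversion), so d ↦ ψ_d|ℋ is injective.
  ψ-determined-by-ℋ : (d : Fin #ℱ → Carrier) → (∀ j → ψ d ℋ[ j ] ≈ 0#) → ∀ x → d x ≈ 0#
  ψ-determined-by-ℋ d ψℋ≈0 = möbius d λ W →
    reduction (ψ d) (λ _ → Unit) (λ _ _ → tt) (Λ-multiple d) vanishes-on-ℋ W tt
    where
    vanishes-on-ℋ : ∀ U → U ∈ ℋ𝒮 → Unit → ψ d U ≈ 0#
    vanishes-on-ℋ U U∈ _ with index U∈
    ... | j , ≡.refl = ψℋ≈0 j

  #ℱ≤#ℋ : #ℱ ≤ #ℋ
  #ℱ≤#ℋ = NP.≮⇒≥ λ #ℋ<#ℱ → dependent #ℋ #ℱ #ℋ<#ℱ (λ x j → indicator (ℋ[ j ] ⊆ᵇ ℱ[ x ]))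
    λ { (d , (x₀ , d≉0) , ψℋ≈0) → d≉0 (ψ-determined-by-ℋ d ψℋ≈0 x₀) }

  unit : Fin #ℋ → Fin #ℋ → Carrier
  unit j₀ j with j Fin.≟ j₀
  ... | yes _ = 1#
  ... | no  _ = 0#

  unit-same : ∀ j → unit j j ≈ 1#
  unit-same j with j Fin.≟ j
  ... | yes _ = refl
  ... | no ne = ⊥-elim (ne ≡.refl)

  unit-other : ∀ {j₀ j} → j ≢ j₀ → unit j₀ j ≈ 0#
  unit-other {j₀} {j} ne with j Fin.≟ j₀
  ... | yes e = ⊥-elim (ne e)
  ... | no _  = refl

  -- If |ℋ| = |ℱ| then d ↦ ψ_d|ℋ is also onto: the unit vectors are hit.
  -- (The |ℱ|+1 vectors e_{j₀} and ψ_{e_x}|ℋ are dependent, and the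
  -- coefficient of e_{j₀} cannot vanish by injectivity.)
  unit-as-ψ : #ℋ ≡ #ℱ → ∀ j₀ → ¬ ¬ (Σ (Fin #ℱ → Carrier) λ d → ∀ j → ψ d ℋ[ j ] ≈ unit j₀ j)
  unit-as-ψ #ℋ≡#ℱ j₀ = ¬¬-bind (dependent #ℋ (suc #ℱ) (s≤s (NP.≤-reflexive #ℋ≡#ℱ)) rows) λ
    { (coef , (i₀ , coef≉0) , vanishes) → ¬¬-bind ¬¬-excluded-middle λ
      { (yes c₀≈0) → ⊥-elim (trivial coef i₀ coef≉0 vanishes c₀≈0)
      ; (no c₀≉0)  → λ ¬goal → ¬goal (solve coef vanishes c₀≉0) } }
    where
    rows : Fin (suc #ℱ) → Fin #ℋ → Carrier
    rows Fin.zero    j = unit j₀ j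
    rows (Fin.suc x) j = indicator (ℋ[ j ] ⊆ᵇ ℱ[ x ])
    rest≈ : ∀ coef → (∀ j → sum (λ i → coef i * rows i j) ≈ 0#) →
            ∀ j → ψ (coef ∘ Fin.suc) ℋ[ j ] ≈ - (coef Fin.zero * unit j₀ j)
    rest≈ coef vanishes j = +-inverseʳ-unique _ _ (vanishes j)
    trivial : ∀ coef i₀ → ¬ (coef i₀ ≈ 0#) → (∀ j → sum (λ i → coef i * rows i j) ≈ 0#) → ¬ (coef Fin.zero ≈ 0#)
    trivial coef Fin.zero    c≉0 _        c₀≈0 = c≉0 c₀≈0
    trivial coef (Fin.suc x) c≉0 vanishes c₀≈0 = c≉0 (ψ-determined-by-ℋ (coef ∘ Fin.suc) (λ j →
      trans (rest≈ coef vanishes j) (trans (-‿cong (trans (*-congʳ c₀≈0) (zeroˡ _))) -0#≈0#)) x)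
    solve : ∀ coef → (∀ j → sum (λ i → coef i * rows i j) ≈ 0#) → ¬ (coef Fin.zero ≈ 0#) →
            Σ (Fin #ℱ → Carrier) λ d → ∀ j → ψ d ℋ[ j ] ≈ unit j₀ j
    solve coef vanishes c₀≉0 with inverse (coef Fin.zero) c₀≉0
    ... | c₀⁻¹ , c₀c₀⁻¹≈1 = (λ x → - c₀⁻¹ * coef (Fin.suc x)) , λ j → begin
      sum (λ x → - c₀⁻¹ * coef (Fin.suc x) * b j x)   ≈⟨ sum-cong-≋ (λ x → *-assoc (- c₀⁻¹) (coef (Fin.suc x)) (b j x)) ⟩
      sum (λ x → - c₀⁻¹ * (coef (Fin.suc x) * b j x)) ≈⟨ *-distribˡ-sum (- c₀⁻¹) (λ x → coef (Fin.suc x) * b j x) ⟨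
      - c₀⁻¹ * ψ (coef ∘ Fin.suc) ℋ[ j ]              ≈⟨ *-congˡ (rest≈ coef vanishes j) ⟩
      - c₀⁻¹ * - (coef Fin.zero * unit j₀ j)          ≈⟨ -‿distribˡ-* _ _ ⟨
      - (c₀⁻¹ * - (coef Fin.zero * unit j₀ j))        ≈⟨ -‿cong (-‿distribʳ-* _ _) ⟨
      - (- (c₀⁻¹ * (coef Fin.zero * unit j₀ j)))      ≈⟨ -‿involutive _ ⟩
      c₀⁻¹ * (coef Fin.zero * unit j₀ j)              ≈⟨ *-assoc _ _ _ ⟨
      (c₀⁻¹ * coef Fin.zero) * unit j₀ j              ≈⟨ *-congʳ (trans (*-comm _ _) c₀c₀⁻¹≈1) ⟩
      1# * unit j₀ j                                  ≈⟨ *-identityˡ _ ⟩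
      unit j₀ j                                       ∎
      where
      b : Fin #ℋ → Fin #ℱ → Carrier
      b j x = indicator (ℋ[ j ] ⊆ᵇ ℱ[ x ])

  module Generators (O : TermOrder n) where
    open LeadingMonomials O

    lm-f : ∀ {S} → S ∈ 𝒮 → IsLM O (f S) (𝐱 S)
    lm-f S∈ = IsLM-top (Within-fSH (h⊑ S∈)) (λ ≈0 → 0≉1 (sym (trans (sym (coeff-fSH-top (h⊑ S∈))) ≈0)))

    lm-quadratic : ∀ i → IsLM O (quadratic i) (square i)
    lm-quadratic i = IsLM-top (Within-quadratic i) (λ ≈0 → 0≉1 (sym (trans (sym (coeff-quadratic i)) ≈0)))

  module Sufficiency (O : TermOrder n) (#ℋ≡#ℱ : #ℋ ≡ #ℱ) where
    open TermOrder O
    open LeadingMonomials O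
    open Generators O

    -- No element of the ideal has leading monomial 𝐱 T with T ∈ ℋ: take d
    -- with ψ_d|ℋ = e_T; then ψ_d(V) = 0 unless T ⊆ V (reduction), so
    -- Λ_d(p) = coeff p (𝐱 T), while Λ_d kills the ideal.
    ℋ-not-leading : ∀ {p T} → p ∈⟨ 𝔾𝒮 ⟩ → IsLM O p (𝐱 T) → T ∈ ℋ𝒮 → ⊥
    ℋ-not-leading {p} {T} p∈I (coeff≉0 , above-zero) T∈ with index T∈
    ... | j₀ , ≡.refl = unit-as-ψ #ℋ≡#ℱ j₀ λ { (d , ψℋ≈unit) → coeff≉0 (begin
      coeff p (𝐱 T)                     ≈⟨ *-identityʳ _ ⟨
      coeff p (𝐱 T) * 1#                ≈⟨ *-congˡ (trans (reflexive (≡.cong (ψ d) (supp-𝐱 T))) (trans (ψℋ≈unit j₀) (unit-same j₀))) ⟨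
      coeff p (𝐱 T) * ψ d (supp (𝐱 T))  ≈⟨ isolation (λ m → ψ d (supp m)) (𝐱 T) p (others d ψℋ≈unit) ⟨
      Λ d p                             ≈⟨ Λ-ideal d {p} p∈I ⟩
      0#                                ∎) }
      where
      others : ∀ d → (∀ j → ψ d ℋ[ j ] ≈ unit j₀ j) → ∀ m → m ≢ 𝐱 T → coeff p m * ψ d (supp m) ≈ 0#
      others d ψℋ≈unit m m≢ with T ⊑? supp m
      ... | yes T⊑ = trans (*-congʳ (above-zero m (∣ₘ⇒≼ (≤ₘ⇒∣ₘ (⊑⇒𝐱≤ T⊑)) , λ e → m≢ (≡.sym e)))) (zeroˡ _)
      ... | no T⋢  = trans (*-congˡ (reduction (ψ d) (λ W → ¬ (T ⊑ W)) (λ V⊑W T⋢W T⊑V → T⋢W (⊑-trans T⊑V V⊑W))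
                                      (Λ-multiple d) off-T (supp m) T⋢)) (zeroʳ _)
        where
        off-T : ∀ U → U ∈ ℋ𝒮 → ¬ (T ⊑ U) → ψ d U ≈ 0#
        off-T U U∈ T⋢U with index U∈
        ... | j , ≡.refl = trans (ψℋ≈unit j) (unit-other {j₀} {j} (λ { ≡.refl → T⋢U (⊑-refl T) }))

    -- Every leading monomial m of the ideal is divisible by some generator's:
    -- by xᵢ² if m is not squarefree, by 𝐱 S if supp m contains S ∈ 𝒮, and
    -- otherwise supp m ∈ ℋ, which ℋ-not-leading excludes.
    groebner : IsGroebnerBasis O 𝔾𝒮
    groebner p p∈I m lm with ≤ₘ-dec m (𝐱 ⊤ₛ)
    ... | no non-squarefree with square-divides m non-squarefree
    ...   | i , i²≤m = quadratic i , square i , quadratic∈𝔾 i , lm-quadratic i , ≤ₘ⇒∣ₘ i²≤m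
    groebner p p∈I m lm | yes squarefree with supp m ∈ᴸ? 𝒫∪
    ...   | yes m∈ with 𝒫∪-elim m∈
    ...     | S , S∈ , S⊑ = f S , 𝐱 S , f∈𝔾 S∈ , lm-f S∈ , ≤ₘ⇒∣ₘ (≡.subst (𝐱 S ≤ₘ_) (𝐱-supp squarefree) (𝐱-mono S⊑))
    groebner p p∈I m lm | yes squarefree | no m∉ =
      ⊥-elim (ℋ-not-leading {p} {supp m} p∈I (≡.subst (IsLM O p) (≡.sym (𝐱-supp squarefree)) lm) (ℋ-intro m∉))

  -- (⇒) Ideal elements with prescribed lowest monomial: for Y ∈ 𝒬_{S,h(S)},
  -- D S Y = f_{∁S, Y∖S} · f_S has all monomials between 𝐱 Y and 𝐱 ⊤, and
  -- a sign as coefficient of 𝐱 Y.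
  D : Subset n → Subset n → Pol
  D S Y = fSH (∁ S) (Y ─ S) *ₚ f S

  private
    D-bottom-monomial : ∀ {S Y} → S ∈ 𝒮 → Y ∈ 𝒬 S (h S) → 𝐱 (Y ─ S) ·ₘ 𝐱 (h S) ≡ 𝐱 Y
    D-bottom-monomial {S} S∈ Y∈ with 𝒬-elim Y∈
    ... | B , ≡.refl , B⊑∁S = 𝐱-𝒬-split (h⊑ S∈) B⊑∁S

  D-within : ∀ {S Y} → S ∈ 𝒮 → Y ∈ 𝒬 S (h S) → Within (𝐱 Y) (𝐱 ⊤ₛ) (D S Y)
  D-within {S} {Y} S∈ Y∈ = Within-subst (D-bottom-monomial S∈ Y∈) (𝐱-∁-split S)
    (Within-* (Within-fSH (─⊑∁ Y S)) (Within-fSH (h⊑ S∈)))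

  D-bottom : ∀ {S Y} → S ∈ 𝒮 → Y ∈ 𝒬 S (h S) → Sign (coeff (D S Y) (𝐱 Y))
  D-bottom {S} {Y} S∈ Y∈ = ≡.subst (λ z → Sign (coeff (D S Y) z)) (D-bottom-monomial S∈ Y∈)
    (trans (*-cong product product) (sign-* (coeff-fSH-bottom (∁ S) (Y ─ S)) (coeff-fSH-bottom S (h S))))
    where
    product : coeff (D S Y) (𝐱 (Y ─ S) ·ₘ 𝐱 (h S)) ≈ coeff (fSH (∁ S) (Y ─ S)) (𝐱 (Y ─ S)) * coeff (f S) (𝐱 (h S))
    product = coeff-bottom (Within-fSH (─⊑∁ Y S)) (Within-fSH (h⊑ S∈))

  coeff-combination : ∀ {k} (a : Fin k → Carrier) (A g : Fin k → Pol) m →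
    coeff (sumₚ (map (λ qg → proj₁ qg *ₚ proj₂ qg) (List.tabulate (λ y → (constₚ (a y) *ₚ A y , g y))))) m
      ≈ sum (λ y → a y * coeff (A y *ₚ g y) m)
  coeff-combination {zero}  a A g m = refl
  coeff-combination {suc k} a A g m =
    trans (coeff-++ ((constₚ (a Fin.zero) *ₚ A Fin.zero) *ₚ g Fin.zero) _ m)
          (+-cong (scaled (a Fin.zero) (A Fin.zero) (g Fin.zero)) (coeff-combination (a ∘ Fin.suc) (A ∘ Fin.suc) (g ∘ Fin.suc) m))
    where
    scaled : ∀ a A B → coeff ((constₚ a *ₚ A) *ₚ B) m ≈ a * coeff (A *ₚ B) m
    scaled a A B = begin
      coeff ((constₚ a *ₚ A) *ₚ B) m               ≈⟨ coeff≈ext-δ ((constₚ a *ₚ A) *ₚ B) m ⟩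
      ext (δ m) ((constₚ a *ₚ A) *ₚ B)             ≈⟨ ext-* (δ m) (constₚ a *ₚ A) B ⟩
      ext φ (constₚ a *ₚ A)                        ≈⟨ ext-* φ (constₚ a) A ⟩
      a * ext (λ m₁ → φ (oneₘ ·ₘ m₁)) A + 0#       ≈⟨ +-identityʳ _ ⟩
      a * ext (λ m₁ → φ (oneₘ ·ₘ m₁)) A            ≈⟨ *-congˡ (ext-cong (λ m₁ → reflexive (≡.cong φ (·ₘ-identityˡ m₁))) A) ⟩
      a * ext φ A                                  ≈⟨ *-congˡ (ext-* (δ m) A B) ⟨
      a * ext (δ m) (A *ₚ B)                       ≈⟨ *-congˡ (coeff≈ext-δ (A *ₚ B) m) ⟨
      a * coeff (A *ₚ B) m                         ∎
      where
      φ : Mon n → Carrier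
      φ m₁ = ext (λ m₂ → δ m (m₁ ·ₘ m₂)) B

  ℋᶜ ℱᶜ : List (Subset n)
  ℋᶜ = filter (_∈ᴸ? 𝒫∪) (allSubsets n)
  ℱᶜ = filter (_∈ᴸ? 𝒬∪) (allSubsets n)

  #ℋᶜ #ℱᶜ : ℕ
  #ℋᶜ = List.length ℋᶜ
  #ℱᶜ = List.length ℱᶜ

  complements-larger : #ℱ < #ℋ → #ℋᶜ < #ℱᶜ
  complements-larger #ℱ<#ℋ = NP.≰⇒> λ #ℱᶜ≤#ℋᶜ → NP.<-irrefl
    (≡.trans (length-complement (_∈ᴸ? 𝒬∪) (allSubsets n)) (≡.sym (length-complement (_∈ᴸ? 𝒫∪) (allSubsets n))))
    (NP.+-mono-<-≤ #ℱ<#ℋ #ℱᶜ≤#ℋᶜ)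

  module Necessity (O : TermOrder n) (groebner : IsGroebnerBasis O 𝔾𝒮) (#ℱ<#ℋ : #ℱ < #ℋ) where
    open TermOrder O
    open LeadingMonomials O
    open Generators O

    Y[_] : Fin #ℱᶜ → Subset n
    Y[_] = lookup ℱᶜ

    source : ∀ y → Σ (Subset n) λ S → (S ∈ 𝒮) × Y[ y ] ∈ 𝒬 S (h S)
    source y = 𝒬∪-elim (proj₂ (∈-filter⁻ (_∈ᴸ? 𝒬∪) {xs = allSubsets n} (∈-lookup y)))

    S[_] : Fin #ℱᶜ → Subset n
    S[ y ] = proj₁ (source y)

    S[_]∈𝒮 : ∀ y → S[ y ] ∈ 𝒮
    S[ y ]∈𝒮 = proj₁ (proj₂ (source y))

    Y[_]∈𝒬 : ∀ y → Y[ y ] ∈ 𝒬 S[ y ] (h S[ y ])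
    Y[ y ]∈𝒬 = proj₂ (proj₂ (source y))

    D[_] : Fin #ℱᶜ → Pol
    D[ y ] = D S[ y ] Y[ y ]

    module Combination (e : Fin #ℱᶜ → Carrier) where

      cofactor : Fin #ℱᶜ → Pol
      cofactor y = fSH (∁ S[ y ]) (Y[ y ] ─ S[ y ])

      -- kept abstract: only coeff-P and P∈ideal are needed about P, and
      -- unfolding the sum makes type checking very expensive
      abstract
        terms : List (Pol × Pol)
        terms = List.tabulate (λ y → (constₚ (e y) *ₚ cofactor y , f S[ y ]))

        P : Pol
        P = sumₚ (map (λ qg → proj₁ qg *ₚ proj₂ qg) terms)

        P∈ideal : P ∈⟨ 𝔾𝒮 ⟩
        P∈ideal = terms , AllP.tabulate⁺ (λ y → f∈𝔾 S[ y ]∈𝒮) , (λ _ → refl)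

        coeff-P : ∀ m → coeff P m ≈ sum (λ y → e y * coeff D[ y ] m)
        coeff-P = coeff-combination e cofactor (λ y → f S[ y ])

      P-squarefree : ∀ m → ¬ (m ≤ₘ 𝐱 ⊤ₛ) → coeff P m ≈ 0#
      P-squarefree m non-squarefree = trans (coeff-P m) (sum-zero λ y →
        trans (*-congˡ (coeff-above (D-within S[ y ]∈𝒮 Y[ y ]∈𝒬) non-squarefree)) (zeroʳ _))

      -- At a smallest Y[y] with e_y ≠ 0, only D[y] contributes.
      P-lowest : (∀ y → Dec (e y ≈ 0#)) → ∀ y₀ → ¬ (e y₀ ≈ 0#) →
                 (∀ y → ¬ (e y ≈ 0#) → size Y[ y₀ ] ≤ size Y[ y ]) → ¬ (coeff P (𝐱 Y[ y₀ ]) ≈ 0#)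
      P-lowest e? y₀ e≉0 minimal P≈0 = *-nonzero e≉0 (sign-nonzero (D-bottom S[ y₀ ]∈𝒮 Y[ y₀ ]∈𝒬))
        (trans (sym (trans (coeff-P (𝐱 Y[ y₀ ])) (sum-single _ y₀ others))) P≈0)
        where
        others : ∀ y → y ≢ y₀ → e y * coeff D[ y ] (𝐱 Y[ y₀ ]) ≈ 0#
        others y y≢y₀ with e? y
        ... | yes e≈0 = trans (*-congʳ e≈0) (zeroˡ _)
        ... | no e≉0′ with ≤ₘ-dec (𝐱 Y[ y ]) (𝐱 Y[ y₀ ])
        ...   | no Y≰ = trans (*-congˡ (coeff-below (D-within S[ y ]∈𝒮 Y[ y ]∈𝒬) Y≰)) (zeroʳ _)
        ...   | yes Y≤ = ⊥-elim (y≢y₀ (lookup-injective (UniqueP.filter⁺ _ (allSubsets-unique n)) y y₀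
                                      (⊑∧size≥⇒≡ (𝐱-mono⁻ Y≤) (minimal y e≉0′))))

      -- Deciding which squarefree coefficients vanish, the ≼-largest nonzero
      -- one is the leading monomial of P.
      P-leading : (∀ k → Dec (coeff P (𝐱 (lookup (allSubsets n) k)) ≈ 0#)) → ∀ W → ¬ (coeff P (𝐱 W) ≈ 0#) →
                  Σ (Subset n) λ W′ → IsLM O P (𝐱 W′)
      P-leading coeff? W coeff≉0 = leading (Extremal.argmin (λ a b → b ≼ a) (λ a b → swap (total≼ a b)) (λ r s → trans≼ s r)
        _ monomial nonzero (λ k → ¬? (coeff? k)) (proj₁ (index (allSubsets-complete W)) , nonzero-W))
        where
        monomial : Fin (List.length (allSubsets n)) → Mon n
        monomial k = 𝐱 (lookup (allSubsets n) k)
        nonzero : Fin (List.length (allSubsets n)) → Set ℓ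
        nonzero k = ¬ (coeff P (monomial k) ≈ 0#)
        nonzero-W : nonzero (proj₁ (index (allSubsets-complete W)))
        nonzero-W = ≡.subst (λ V → ¬ (coeff P (𝐱 V) ≈ 0#)) (≡.sym (proj₂ (index (allSubsets-complete W)))) coeff≉0
        leading : (Σ _ λ k → nonzero k × (∀ k′ → nonzero k′ → monomial k′ ≼ monomial k)) →
                  Σ (Subset n) λ W′ → IsLM O P (𝐱 W′)
        leading (k , coeff≉0 , maximal) = lookup (allSubsets n) k , coeff≉0 , above
          where
          above : ∀ m′ → monomial k ≺ m′ → coeff P m′ ≈ 0#
          above m′ (k≼m′ , k≢m′) with ≤ₘ-dec m′ (𝐱 ⊤ₛ)
          ... | no non-squarefree = P-squarefree m′ non-squarefree
          ... | yes squarefree = decide (coeff? k′)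
            where
            k′ = proj₁ (index (allSubsets-complete (supp m′)))
            k′↦m′ : monomial k′ ≡ m′
            k′↦m′ = ≡.trans (≡.cong 𝐱 (proj₂ (index (allSubsets-complete (supp m′))))) (𝐱-supp squarefree)
            decide : Dec (coeff P (monomial k′) ≈ 0#) → coeff P m′ ≈ 0#
            decide (yes ≈0) = ≡.subst (λ z → coeff P z ≈ 0#) k′↦m′ ≈0
            decide (no ≉0)  = ⊥-elim (k≢m′ (antisym≼ k≼m′ (≡.subst (_≼ monomial k) k′↦m′ (maximal k′ ≉0))))
      -- When P vanishes at every 𝐱 W with W ∉ ℋ, no generator's leading
      -- monomial divides lm(P): a contradiction with 𝔾 being a Gröbner basis.
      not-leading : (∀ i → coeff P (𝐱 (lookup ℋᶜ i)) ≈ 0#) → ∀ W → IsLM O P (𝐱 W) → ⊥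
      not-leading P≈0-on-ℋᶜ W lm@(coeff≉0 , _) with groebner P P∈ideal (𝐱 W) lm
      ... | g , m , g∈ , lm-g , m∣ with 𝔾-cases g∈
      ...   | inj₁ (S , S∈ , ≡.refl) = W∉𝒫∪ (𝒫∪-intro S∈ (𝐱-mono⁻ (≡.subst (_≤ₘ 𝐱 W) (IsLM-unique {f S} lm-g (lm-f S∈)) (∣ₘ⇒≤ₘ m∣))))
        where
        W∉𝒫∪ : ¬ (W ∈ 𝒫∪)
        W∉𝒫∪ W∈ with index (∈-filter⁺ (_∈ᴸ? 𝒫∪) (allSubsets-complete W) W∈)
        ... | i , ≡.refl = coeff≉0 (P≈0-on-ℋᶜ i)
      ...   | inj₂ (i , ≡.refl) = square-not-squarefree i
              (≤ₘ-trans (≡.subst (_≤ₘ 𝐱 W) (IsLM-unique {quadratic i} lm-g (lm-quadratic i)) (∣ₘ⇒≤ₘ m∣)) (𝐱≤𝐱⊤ W))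

    -- More sets Y ∉ ℱ than W ∉ ℋ: some nontrivial P = Σ e_y D[y] vanishes at
    -- all 𝐱 W with W ∉ ℋ.  It is nonzero (P-lowest) and has a leading
    -- monomial (P-leading), which not-leading rules out.
    contradiction : ⊥
    contradiction = dependent #ℋᶜ #ℱᶜ (complements-larger #ℱ<#ℋ) rows refute
      where
      rows : Fin #ℱᶜ → Fin #ℋᶜ → Carrier
      rows y i = coeff D[ y ] (𝐱 (lookup ℋᶜ i))

      refute : ¬ Dependent #ℱᶜ #ℋᶜ rows
      refute (e , (y₀ , e≉0) , vanishes) =
        ¬¬-decide #ℱᶜ (λ y → e y ≈ 0#) λ e? →
        ¬¬-decide _ (λ k → coeff P (𝐱 (lookup (allSubsets n) k)) ≈ 0#) λ coeff? →
        from-lowest e? coeff? (Extremal.argmin ℕ._≤_ NP.≤-total NP.≤-trans #ℱᶜ (λ y → size Y[ y ])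
                                 (λ y → ¬ (e y ≈ 0#)) (λ y → ¬? (e? y)) (y₀ , e≉0))
        where
        open Combination e
        from-lowest : (∀ y → Dec (e y ≈ 0#)) → (∀ k → Dec (coeff P (𝐱 (lookup (allSubsets n) k)) ≈ 0#)) →
                      (Σ (Fin #ℱᶜ) λ y → ¬ (e y ≈ 0#) × (∀ y′ → ¬ (e y′ ≈ 0#) → size Y[ y ] ≤ size Y[ y′ ])) → ⊥
        from-lowest e? coeff? (y , e≉0′ , minimal) = from-leading (P-leading coeff? Y[ y ] (P-lowest e? y e≉0′ minimal))
          where
          from-leading : (Σ (Subset n) λ W → IsLM O P (𝐱 W)) → ⊥
          from-leading (W , lm) = not-leading (λ i → trans (coeff-P (𝐱 (lookup ℋᶜ i))) (vanishes i)) W lm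

  characterisation : (∃ λ (O : TermOrder n) → IsGroebnerBasis O 𝔾𝒮) ⇔ (#ℋ ≡ #ℱ)
  characterisation = mk⇔
    (λ { (O , groebner) → NP.≤-antisym (NP.≮⇒≥ (Necessity.contradiction O groebner)) #ℱ≤#ℋ })
    (λ #ℋ≡#ℱ → lexOrder n , Sufficiency.groebner (lexOrder n) #ℋ≡#ℱ)

-- Theorem 2.2.

theorem22 : ∀ {c ℓ} (F : Field c ℓ) (n : ℕ) (𝒮 : List (Subset n)) (h : Subset n → Subset n) →
              IsSperner 𝒮 → (∀ {S} → S ∈ 𝒮 → h S ⊆ S) →
              (∃ λ (O : TermOrder n) → Poly.IsGroebnerBasis F n O (Poly.𝔾 F n 𝒮 h))
                ⇔ (length (ℋ 𝒮) ≡ length (ℱ 𝒮 h))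
theorem22 F n 𝒮 h _ h⊆ = Main.characterisation F n 𝒮 h h⊆
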